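{- Let $G$ be an $m\times m$ grid graph and let $e_1=(u_1,v_1)$, $e_2=(u_2,v_2)$ and $f=(x,y)$ be edges of the $\alpha$-auxiliary graph $\widetilde{G}$ (in a common block). If $e_1$ and $e_2$ both cross $f$, and $e_1$ is closer to $x$ than $e_2$, then the edge $(u_1,v_2)$ is also present in $\widetilde{G}$.
   Context: An $m\times m$ grid graph is a directed graph on vertex set $\{0,\dots,m\}^2$ whose edges join vertices at Manhattan distance $1$. Fix $0<\alpha<1$ with $t=m^{1-\alpha}$ and $m^{\alpha}$ integers. For $1\le i,j\le m^{\alpha}$ the subgrid $G[i,j]$ is the subgraph of $G$ induced by $\{(i',j'): (i-1)t\le i'\le it,\ (j-1)t\le j'\le jt\}$. The block $l=\widetilde{G}[i,j]$ has as vertices the boundary vertices of this square, and $(u,v)$ is an edge of the block if there is a directed path from $u$ to $v$ inside $G[i,j]$. The $\alpha$-auxiliary graph $\widetilde{G}$ is the union of all blocks (edges shared by adjacent blocks kept as distinct parallel edges, one per block). For a vertex $v$ of block $l$, $c_l(v)$ is the next boundary vertex counter-clockwise along the square of $l$, $c_l^0(v)=v$, $c_l^{r+1}(v)=c_l(c_l^r(v))$, exponents taken as the smallest non-negative such integer. Two distinct edges $e,f$ of block $l$ with $e=(v,c_l^p(v))$ and $f=(c_l^q(v),c_l^r(v))$ cross each other if $\min(q,r)<p<\max(q,r)$. For a vertex $v$ of $l$ and edges $f=(c_l^q(v),c_l^r(v))$, $g=(c_l^s(v),c_l^t(v))$ of $l$, $f$ is closer to $v$ than $g$ if $\min(q,r)<\min(s,t)$.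 -}

module Defs where

open import Data.Nat using (ℕ; zero; suc; _+_; _*_; _∸_; _≤_; _<_; _≡ᵇ_; _<ᵇ_)
open import Data.Nat using (_⊓_; _⊔_) public
open import Data.Bool using (Bool; true; false; if_then_else_; _∧_)
open import Data.Product using (_×_; _,_; Σ; Σ-syntax)
open import Data.Sum using (_⊎_)
open import Relation.Binary.PropositionalEquality using (_≡_; _≢_)
open import Relation.Binary.Construct.Closure.ReflexiveTransitive using (Star)

-- Vertices of the grid are pairs of naturals (the first coordinate is the
-- horizontal one, the second the vertical one).
Point : Set
Point = ℕ × ℕ

InGrid : ℕ → Point → Set
InGrid m (a , b) = a ≤ m × b ≤ m

Adjacent : Point → Point → Set
Adjacent (a , b) (c , d) =
  (a ≡ c × (suc b ≡ d ⊎ suc d ≡ b)) ⊎ (b ≡ d × (suc a ≡ c ⊎ suc c ≡ a))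

record GridGraph (m : ℕ) : Set₁ where
  field
    Edge          : Point → Point → Set
    edge-inGrid   : ∀ {u v} → Edge u v → InGrid m u × InGrid m v
    edge-adjacent : ∀ {u v} → Edge u v → Adjacent u v
open GridGraph public

-- Parameters: t = m^(1-α) and k = m^α with m = k * t and 0 < α < 1.
-- For integer k, t this is possible exactly when k ≥ 2 and t ≥ 2,
-- or k = t = 1 (m = 1), or k = t = 0 (m = 0, no blocks at all).
AdmissibleSplit : ℕ → ℕ → Set
AdmissibleSplit k t = (2 ≤ k × 2 ≤ t) ⊎ (k ≡ 1 × t ≡ 1) ⊎ (k ≡ 0 × t ≡ 0)

-- Corners of the square of the subgrid G[i,j] (side length t).
lo hi : ℕ → ℕ → ℕ
lo t i = (i ∸ 1) * t
hi t i = i * t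

InSquare : ℕ → ℕ → ℕ → Point → Set
InSquare t i j (a , b) = (lo t i ≤ a × a ≤ hi t i) × (lo t j ≤ b × b ≤ hi t j)

OnBoundary : ℕ → ℕ → ℕ → Point → Set
OnBoundary t i j (a , b) =
  InSquare t i j (a , b) ×
  ((a ≡ lo t i ⊎ a ≡ hi t i) ⊎ (b ≡ lo t j ⊎ b ≡ hi t j))

SubEdge : ∀ {m} → GridGraph m → ℕ → ℕ → ℕ → Point → Point → Set
SubEdge G t i j u v = Edge G u v × InSquare t i j u × InSquare t i j v

-- (u , v) is an edge of the block G̃[i,j]: u, v boundary vertices and a
-- directed path (possibly of length 0) from u to v inside G[i,j].
BlockEdge : ∀ {m} → GridGraph m → ℕ → ℕ → ℕ → Point → Point → Set
BlockEdge G t i j u v =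
  OnBoundary t i j u × OnBoundary t i j v × Star (SubEdge G t i j) u v

-- c_l : next boundary vertex counter-clockwise along the square
-- (bottom side rightwards, right side upwards, top side leftwards,
--  left side downwards).
ccw : ℕ → ℕ → ℕ → Point → Point
ccw t i j (a , b) =
  if (b ≡ᵇ lo t j) ∧ (a <ᵇ hi t i) then (suc a , b)
  else if (a ≡ᵇ hi t i) ∧ (b <ᵇ hi t j) then (a , suc b)
  else if (b ≡ᵇ hi t j) ∧ (lo t i <ᵇ a) then (a ∸ 1 , b)
  else (a , b ∸ 1)

ccw^ : ℕ → ℕ → ℕ → ℕ → Point → Point
ccw^ t i j zero    v = v
ccw^ t i j (suc n) v = ccw t i j (ccw^ t i j n v)

Exponent : ℕ → ℕ → ℕ → Point → Point → ℕ → Set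
Exponent t i j v w n =
  ccw^ t i j n v ≡ w × (∀ n' → n' < n → ccw^ t i j n' v ≢ w)

Crosses : ℕ → ℕ → ℕ → Point × Point → Point × Point → Set
Crosses t i j (v , w) (a , b) =
  (v , w) ≢ (a , b) ×
  Σ[ p ∈ ℕ ] Σ[ q ∈ ℕ ] Σ[ r ∈ ℕ ]
    (Exponent t i j v w p × Exponent t i j v a q × Exponent t i j v b r ×
     q ⊓ r < p × p < q ⊔ r)

Closer : ℕ → ℕ → ℕ → Point → Point × Point → Point × Point → Set
Closer t i j v (a , b) (c , d) =
  Σ[ q ∈ ℕ ] Σ[ r ∈ ℕ ] Σ[ s ∈ ℕ ] Σ[ u ∈ ℕ ]
    (Exponent t i j v a q × Exponent t i j v b r ×
     Exponent t i j v c s × Exponent t i j v d u ×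
     q ⊓ r < s ⊓ u)

module Submission where

-- The topological input is a discrete Jordan curve theorem for the square
-- (walks-meet): a walk A between boundary points α, β meets every walk
-- from a boundary point outside the arc of α, β to one inside it.  It is
-- proved with a parity invariant: the parity of crossings of a rightward
-- ray with A, closed up by escape routes of α and β out of the square, is
-- constant along walks avoiding A (Separation.side-walk); at a boundary
-- point it is the parity of how many of α, β precede the point
-- counter-clockwise (side-arcParity), and along the orbit of ccw from x
-- this parity only depends on the exponents (arcParity-exponent).

open import Defs
open import Data.Nat using (ℕ; zero; suc; _+_; _*_; _∸_; _≤_; _<_; _≡ᵇ_; _<ᵇ_; z≤n; s≤s; s≤s⁻¹)
open import Data.Nat.Properties
open import Relation.Binary.Definitions using (tri<; tri≈; tri>)
open import Data.Bool using (Bool; true; false; _∧_; _∨_; _xor_; T; if_then_else_)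
open import Data.Bool.Properties
  using (xor-same; xor-assoc; if-eta; xor-comm; xor-identityʳ; ∧-identityʳ; ∧-zeroʳ; not-injective; xor-∧-commutativeRing)
open import Algebra.Bundles using (CommutativeRing)
open import Algebra.Properties.CommutativeSemigroup
  (CommutativeRing.+-commutativeSemigroup xor-∧-commutativeRing) using () renaming (interchange to xor-interchange)
open import Data.Product using (_×_; _,_; ∃-syntax; proj₁; proj₂)
open import Data.Sum using (_⊎_; inj₁; inj₂)
open import Data.Empty using (⊥-elim)
open import Data.Unit using (tt)
open import Function using (_∘_)
open import Relation.Nullary using (¬_; Dec; yes; no)
open import Relation.Nullary.Decidable using (_⊎-dec_)
open import Data.Product.Properties using (≡-dec)
open import Relation.Binary.PropositionalEquality
  using (_≡_; _≢_; refl; sym; trans; cong; cong₂; subst; subst₂; module ≡-Reasoning)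
open import Relation.Binary.Construct.Closure.ReflexiveTransitive
  using (Star; ε; _◅_; _◅◅_; map; revApp; reverse)

open ≡-Reasoning

data EqView (m n : ℕ) : Bool → Set where
  equal   : m ≡ n → EqView m n true
  unequal : m ≢ n → EqView m n false

eq-view : ∀ m n → EqView m n (m ≡ᵇ n)
eq-view m n with m ≡ᵇ n in eq
... | true  = equal (≡ᵇ⇒≡ m n (subst T (sym eq) tt))
... | false = unequal (λ p → subst T eq (≡⇒≡ᵇ m n p))

data LtView (m n : ℕ) : Bool → Set where
  less    : m < n → LtView m n true
  notLess : n ≤ m → LtView m n false

lt-view : ∀ m n → LtView m n (m <ᵇ n)
lt-view m n with m <ᵇ n in eq
... | true  = less (<ᵇ⇒< m n (subst T (sym eq) tt))
... | false = notLess (≮⇒≥ (λ p → subst T eq (<⇒<ᵇ p)))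

≡ᵇ-refl : ∀ n → (n ≡ᵇ n) ≡ true
≡ᵇ-refl zero    = refl
≡ᵇ-refl (suc n) = ≡ᵇ-refl n

≡ᵇ-true : ∀ m n → m ≡ n → (m ≡ᵇ n) ≡ true
≡ᵇ-true m .m refl = ≡ᵇ-refl m

≡ᵇ-false : ∀ m n → m ≢ n → (m ≡ᵇ n) ≡ false
≡ᵇ-false m n m≢n with m ≡ᵇ n | eq-view m n
... | .false | unequal _ = refl
... | .true  | equal m≡n = ⊥-elim (m≢n m≡n)

≡ᵇ-sym : ∀ m n → (m ≡ᵇ n) ≡ (n ≡ᵇ m)
≡ᵇ-sym zero    zero    = refl
≡ᵇ-sym zero    (suc n) = refl
≡ᵇ-sym (suc m) zero    = refl
≡ᵇ-sym (suc m) (suc n) = ≡ᵇ-sym m n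

<ᵇ-true : ∀ m n → m < n → (m <ᵇ n) ≡ true
<ᵇ-true m n m<n with m <ᵇ n | lt-view m n
... | .true  | less _      = refl
... | .false | notLess n≤m = ⊥-elim (<⇒≱ m<n n≤m)

<ᵇ-false : ∀ m n → n ≤ m → (m <ᵇ n) ≡ false
<ᵇ-false m n n≤m with m <ᵇ n | lt-view m n
... | .false | notLess _ = refl
... | .true  | less m<n  = ⊥-elim (<⇒≱ m<n n≤m)

xor-absorb : ∀ x y → x xor (x xor y) ≡ y
xor-absorb x y = trans (sym (xor-assoc x x y)) (cong (_xor y) (xor-same x))

xor-telescope : ∀ a b c → (a xor b) xor (b xor c) ≡ a xor c
xor-telescope a b c = begin
  (a xor b) xor (b xor c) ≡⟨ cong ((a xor b) xor_) (xor-comm b c) ⟩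
  (a xor b) xor (c xor b) ≡⟨ xor-interchange a b c b ⟩
  (a xor c) xor (b xor b) ≡⟨ cong ((a xor c) xor_) (xor-same b) ⟩
  (a xor c) xor false     ≡⟨ xor-identityʳ (a xor c) ⟩
  a xor c                 ∎

xor-cancelˡ : ∀ k a b → k xor a ≡ k xor b → a ≡ b
xor-cancelˡ false a b eq = eq
xor-cancelˡ true  a b eq = not-injective eq

xor-cancelʳ : ∀ k a b → a xor k ≡ b xor k → a ≡ b
xor-cancelʳ k a b eq = xor-cancelˡ k a b (trans (xor-comm k a) (trans eq (xor-comm b k)))

xor≡false⇒≡ : ∀ a b → a xor b ≡ false → a ≡ b
xor≡false⇒≡ false false _ = refl
xor≡false⇒≡ true  true  _ = refl

xor-transpose : ∀ a a' b b' → a xor a' ≡ b xor b' → a xor b ≡ a' xor b'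
xor-transpose a a' b b' eq = xor≡false⇒≡ _ _ (begin
  (a xor b) xor (a' xor b')   ≡⟨ xor-interchange a b a' b' ⟩
  (a xor a') xor (b xor b')   ≡⟨ cong (_xor (b xor b')) eq ⟩
  (b xor b') xor (b xor b')   ≡⟨ xor-same (b xor b') ⟩
  false                       ∎)

<ᵇ-sucʳ : ∀ r c → (r <ᵇ suc c) ≡ (r <ᵇ c) xor (r ≡ᵇ c)
<ᵇ-sucʳ zero    zero    = refl
<ᵇ-sucʳ zero    (suc c) = refl
<ᵇ-sucʳ (suc r) zero    = refl
<ᵇ-sucʳ (suc r) (suc c) = <ᵇ-sucʳ r c

<ᵇ-step : ∀ y k → (y <ᵇ k) xor (suc y <ᵇ k) ≡ (suc y ≡ᵇ k)
<ᵇ-step y       zero          = refl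
<ᵇ-step zero    (suc zero)    = refl
<ᵇ-step zero    (suc (suc k)) = refl
<ᵇ-step (suc y) (suc k)       = <ᵇ-step y k

<ᵇ-sucʳ-xor : ∀ r c → (r <ᵇ c) xor (r <ᵇ suc c) ≡ (r ≡ᵇ c)
<ᵇ-sucʳ-xor r c = trans (cong ((r <ᵇ c) xor_) (<ᵇ-sucʳ r c)) (xor-absorb (r <ᵇ c) (r ≡ᵇ c))

<ᵇ-suc-≥ : ∀ r y → y ≤ r → (r <ᵇ suc y) ≡ (r ≡ᵇ y)
<ᵇ-suc-≥ r y y≤r = trans (<ᵇ-sucʳ r y) (cong (_xor (r ≡ᵇ y)) (<ᵇ-false r y y≤r))

<ᵇ-suc-≤ : ∀ c n → c ≤ n → (n <ᵇ suc c) ≡ (c ≡ᵇ n)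
<ᵇ-suc-≤ c n c≤n = trans (<ᵇ-suc-≥ n c c≤n) (≡ᵇ-sym n c)

<ᵇ-suc-≢ : ∀ r c → r ≢ c → (r <ᵇ suc c) ≡ (r <ᵇ c)
<ᵇ-suc-≢ r c r≢c =
  trans (<ᵇ-sucʳ r c) (trans (cong ((r <ᵇ c) xor_) (≡ᵇ-false r c r≢c)) (xor-identityʳ _))

<ᵇ-sucˡ-≢ : ∀ a c → c ≢ suc a → (a <ᵇ c) ≡ (suc a <ᵇ c)
<ᵇ-sucˡ-≢ a c c≢1+a = xor≡false⇒≡ _ _ (trans (<ᵇ-step a c) (≡ᵇ-false (suc a) c (λ e → c≢1+a (sym e))))

<ᵇ-flip : ∀ a c → (a <ᵇ c) ≡ (c <ᵇ suc a) xor true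
<ᵇ-flip zero    zero    = refl
<ᵇ-flip zero    (suc c) = refl
<ᵇ-flip (suc a) zero    = refl
<ᵇ-flip (suc a) (suc c) = <ᵇ-flip a c

<ᵇ-flip′ : ∀ a c → (c <ᵇ suc a) ≡ (a <ᵇ c) xor true
<ᵇ-flip′ a c = begin
  c <ᵇ suc a                        ≡⟨ xor-identityʳ _ ⟨
  (c <ᵇ suc a) xor false            ≡⟨ xor-assoc (c <ᵇ suc a) true true ⟨
  ((c <ᵇ suc a) xor true) xor true  ≡⟨ cong (_xor true) (<ᵇ-flip a c) ⟨
  (a <ᵇ c) xor true                 ∎

Between Outside : ℕ → ℕ → ℕ → Set
Between a b n = a ⊓ b < n × n < a ⊔ b
Outside a b n = n < a ⊓ b ⊎ a ⊔ b < n

inRange : ℕ → ℕ → Bool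
inRange e n = (0 <ᵇ e) ∧ (e <ᵇ suc n)

inRange-suc : ∀ e n → e ≢ suc n → inRange e (suc n) ≡ inRange e n
inRange-suc e n e≢1+n = cong ((0 <ᵇ e) ∧_) (<ᵇ-suc-≢ e (suc n) e≢1+n)

inRange-hit : ∀ n → inRange (suc n) (suc n) ≡ inRange (suc n) n xor true
inRange-hit n rewrite <ᵇ-true n (suc n) ≤-refl | <ᵇ-false n n ≤-refl = refl

inRange-separates : ∀ a b n n' → Between a b n → Outside a b n' →
                    inRange a n xor inRange b n ≢ inRange a n' xor inRange b n'
inRange-separates a b n n' = either-order a b n n' (≤-total a b)
  where
  -- when a ≤ b: one of a, b lies in [1, n] but, for n' outside, both or neither
  ordered : ∀ a b n n' → a < n → n < b → (n' < a ⊎ b < n') →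
            inRange a n xor inRange b n ≢ inRange a n' xor inRange b n'
  ordered a b n n' a<n n<b (inj₂ b<n')
    rewrite <ᵇ-true a (suc n) (m<n⇒m<1+n a<n) | <ᵇ-false b (suc n) n<b
          | <ᵇ-true a (suc n') (m<n⇒m<1+n (<-trans a<n (<-trans n<b b<n')))
          | <ᵇ-true b (suc n') (m<n⇒m<1+n b<n') | <ᵇ-true 0 b (≤-trans (s≤s z≤n) n<b) with 0 <ᵇ a
  ... | true  = λ ()
  ... | false = λ ()
  ordered a b n n' a<n n<b (inj₁ n'<a)
    rewrite <ᵇ-true a (suc n) (m<n⇒m<1+n a<n) | <ᵇ-false b (suc n) n<b | <ᵇ-false a (suc n') n'<a
          | <ᵇ-false b (suc n') (<-trans n'<a (<-trans a<n n<b)) | <ᵇ-true 0 a (≤-trans (s≤s z≤n) n'<a)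
          | ∧-zeroʳ (0 <ᵇ b) = λ ()

  either-order : ∀ a b n n' → a ≤ b ⊎ b ≤ a → Between a b n → Outside a b n' →
                 inRange a n xor inRange b n ≢ inRange a n' xor inRange b n'
  either-order a b n n' (inj₁ a≤b) (p , q) r rewrite m≤n⇒m⊓n≡m a≤b | m≤n⇒m⊔n≡n a≤b = ordered a b n n' p q r
  either-order a b n n' (inj₂ b≤a) (p , q) r rewrite m≥n⇒m⊓n≡n b≤a | m≥n⇒m⊔n≡m b≤a = λ e →
    ordered b a n n' p q r (trans (xor-comm (inRange b n) (inRange a n)) (trans e (xor-comm (inRange a n') (inRange b n'))))

_∈ₚ_ : ∀ {T : Point → Point → Set} {u v} → Point → Star T u v → Set
_∈ₚ_ {u = u} z ε       = z ≡ u
_∈ₚ_ {u = u} z (_ ◅ P) = z ≡ u ⊎ z ∈ₚ P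

_⊆ₚ_ : ∀ {T U : Point → Point → Set} {u v u' v'} → Star T u v → Star U u' v' → Set
P ⊆ₚ Q = ∀ {z} → z ∈ₚ P → z ∈ₚ Q

module _ {T : Point → Point → Set} where

  ∈-start : ∀ {u v} (P : Star T u v) → u ∈ₚ P
  ∈-start ε       = refl
  ∈-start (_ ◅ _) = inj₁ refl

  ∈-end : ∀ {u v} (P : Star T u v) → v ∈ₚ P
  ∈-end ε       = refl
  ∈-end (_ ◅ P) = inj₂ (∈-end P)

  ∈-endpoint : ∀ {u v z} (P : Star T u v) → z ≡ u ⊎ z ≡ v → z ∈ₚ P
  ∈-endpoint P (inj₁ refl) = ∈-start P
  ∈-endpoint P (inj₂ refl) = ∈-end P

  ∈-◅◅ : ∀ {u v w z} (P : Star T u v) (Q : Star T v w) → z ∈ₚ (P ◅◅ Q) → z ∈ₚ P ⊎ z ∈ₚ Q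
  ∈-◅◅ ε       Q z∈       = inj₂ z∈
  ∈-◅◅ (_ ◅ P) Q (inj₁ z≡) = inj₁ (inj₁ z≡)
  ∈-◅◅ (_ ◅ P) Q (inj₂ z∈) with ∈-◅◅ P Q z∈
  ... | inj₁ z∈P = inj₁ (inj₂ z∈P)
  ... | inj₂ z∈Q = inj₂ z∈Q

  ∈-map : ∀ {U : Point → Point → Set} {g : ∀ {a b} → T a b → U a b} {u v z}
          (P : Star T u v) → z ∈ₚ map g P → z ∈ₚ P
  ∈-map ε       z∈        = z∈
  ∈-map (_ ◅ P) (inj₁ z≡) = inj₁ z≡
  ∈-map (_ ◅ P) (inj₂ z∈) = inj₂ (∈-map P z∈)

  module _ (flip : ∀ {a b} → T a b → T b a) where

    ∈-revApp : ∀ {u v w z} (P : Star T v u) (acc : Star T v w) →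
               z ∈ₚ revApp flip P acc → z ∈ₚ P ⊎ z ∈ₚ acc
    ∈-revApp ε       acc z∈ = inj₂ z∈
    ∈-revApp (x ◅ P) acc z∈ with ∈-revApp P (flip x ◅ acc) z∈
    ... | inj₁ z∈P         = inj₁ (inj₂ z∈P)
    ... | inj₂ (inj₁ refl) = inj₁ (inj₂ (∈-start P))
    ... | inj₂ (inj₂ z∈a)  = inj₂ z∈a

    ∈-reverse : ∀ {u v z} (P : Star T u v) → z ∈ₚ reverse flip P → z ∈ₚ P
    ∈-reverse P z∈ with ∈-revApp P ε z∈
    ... | inj₁ z∈P  = z∈P
    ... | inj₂ refl = ∈-start P

  ∈-dec : ∀ z {u v} (P : Star T u v) → Dec (z ∈ₚ P)
  ∈-dec z {u} ε       = ≡-dec _≟_ _≟_ z u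
  ∈-dec z {u} (_ ◅ P) = ≡-dec _≟_ _≟_ z u ⊎-dec ∈-dec z P

  meet-or-disjoint : ∀ {U : Point → Point → Set} {u v u' v'} (P : Star T u v) (Q : Star U u' v') →
                     (∃[ z ] z ∈ₚ P × z ∈ₚ Q) ⊎ (∀ {z} → z ∈ₚ Q → ¬ z ∈ₚ P)
  meet-or-disjoint P (ε {u'}) with ∈-dec u' P
  ... | yes u'∈P = inj₁ (u' , u'∈P , refl)
  ... | no  u'∉P = inj₂ λ { refl → u'∉P }
  meet-or-disjoint P (_◅_ {u'} _ Q) with ∈-dec u' P | meet-or-disjoint P Q
  ... | yes u'∈P | _                    = inj₁ (u' , u'∈P , inj₁ refl)
  ... | no  _    | inj₁ (z , z∈P , z∈Q) = inj₁ (z , z∈P , inj₂ z∈Q)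
  ... | no  u'∉P | inj₂ disjoint        = inj₂ λ { (inj₁ refl) → u'∉P ; (inj₂ z∈Q) → disjoint z∈Q }

  record Split {u v : Point} (z : Point) (P : Star T u v) : Set where
    field
      prefix  : Star T u z
      suffix  : Star T z v
      prefix⊆ : prefix ⊆ₚ P
      suffix⊆ : suffix ⊆ₚ P

  split : ∀ {u v z} (P : Star T u v) → z ∈ₚ P → Split z P
  split ε refl = record { prefix = ε ; suffix = ε ; prefix⊆ = λ z∈ → z∈ ; suffix⊆ = λ z∈ → z∈ }
  split (x ◅ P) (inj₁ refl) =
    record { prefix = ε ; suffix = x ◅ P ; prefix⊆ = inj₁ ; suffix⊆ = λ z∈ → z∈ }
  split {z = z} (x ◅ P) (inj₂ z∈P) =
    record { prefix  = x ◅ Split.prefix S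
           ; suffix  = Split.suffix S
           ; prefix⊆ = λ { (inj₁ r) → inj₁ r ; (inj₂ r) → inj₂ (Split.prefix⊆ S r) }
           ; suffix⊆ = λ r → inj₂ (Split.suffix⊆ S r) }
    where
    S : Split z P
    S = split P z∈P

module Square (t i j : ℕ) (xl<xh : lo t i < hi t i) (yl<yh : lo t j < hi t j) where

  xl xh yl yh : ℕ
  xl = lo t i
  xh = hi t i
  yl = lo t j
  yh = hi t j

  Sq Bd : Point → Set
  Sq = InSquare t i j
  Bd = OnBoundary t i j

  testBottom testRight testTop : Point → Bool
  testBottom (a , b) = (b ≡ᵇ yl) ∧ (a <ᵇ xh)
  testRight  (a , b) = (a ≡ᵇ xh) ∧ (b <ᵇ yh)
  testTop    (a , b) = (b ≡ᵇ yh) ∧ (xl <ᵇ a)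

  caseSide : ∀ {A : Set} → Bool → Bool → Bool → A → A → A → A → A
  caseSide true  _     _     xB xR xT xL = xB
  caseSide false true  _     xB xR xT xL = xR
  caseSide false false true  xB xR xT xL = xT
  caseSide false false false xB xR xT xL = xL

  bySide : ∀ {A : Set} → Point → A → A → A → A → A
  bySide w = caseSide (testBottom w) (testRight w) (testTop w)

  ccw-bySide : ∀ w → ccw t i j w ≡ bySide w (suc (proj₁ w) , proj₂ w) (proj₁ w , suc (proj₂ w))
                                               (proj₁ w ∸ 1 , proj₂ w) (proj₁ w , proj₂ w ∸ 1)
  ccw-bySide w with testBottom w
  ... | true = refl
  ... | false with testRight w
  ...   | true = refl
  ...   | false with testTop w
  ...     | true  = refl
  ...     | false = refl

  -- The boundary is the disjoint union of four half-open sides, each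
  -- traversed counter-clockwise up to (and excluding) its last corner.
  data Side : Point → Set where
    bottom : ∀ {a b} → b ≡ yl → xl ≤ a → a < xh → Side (a , b)
    right  : ∀ {a b} → a ≡ xh → yl ≤ b → b < yh → Side (a , b)
    top    : ∀ {a b} → b ≡ yh → xl < a → a ≤ xh → Side (a , b)
    left   : ∀ {a b} → a ≡ xl → yl < b → b ≤ yh → Side (a , b)

  onSide : ∀ {A : Set} {w} → Side w → A → A → A → A → A
  onSide (bottom _ _ _) xB xR xT xL = xB
  onSide (right  _ _ _) xB xR xT xL = xR
  onSide (top    _ _ _) xB xR xT xL = xT
  onSide (left   _ _ _) xB xR xT xL = xL

  bySide-onSide : ∀ {A : Set} {w} (s : Side w) (xB xR xT xL : A) →
                  bySide w xB xR xT xL ≡ onSide s xB xR xT xL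
  bySide-onSide {w = a , b} (bottom refl p q) xB xR xT xL
    rewrite ≡ᵇ-refl yl | <ᵇ-true a xh q = refl
  bySide-onSide {w = a , b} (right refl p q) xB xR xT xL
    rewrite <ᵇ-false xh xh ≤-refl | ∧-zeroʳ (b ≡ᵇ yl) | ≡ᵇ-refl xh | <ᵇ-true b yh q = refl
  bySide-onSide {w = a , b} (top refl p q) xB xR xT xL
    rewrite ≡ᵇ-false yh yl (λ e → <⇒≢ yl<yh (sym e)) | <ᵇ-false yh yh ≤-refl
          | ∧-zeroʳ (a ≡ᵇ xh) | ≡ᵇ-refl yh | <ᵇ-true xl a p = refl
  bySide-onSide {w = a , b} (left refl p q) xB xR xT xL
    rewrite ≡ᵇ-false b yl (λ e → <⇒≢ p (sym e)) | ≡ᵇ-false xl xh (<⇒≢ xl<xh)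
          | <ᵇ-false xl xl ≤-refl | ∧-zeroʳ (b ≡ᵇ yh) = refl

  side-of : ∀ {w} → Bd w → Side w
  side-of {a , b} (((xa , ax) , (yb , by)) , sd) with b ≡ᵇ yl | eq-view b yl | a <ᵇ xh | lt-view a xh
  ... | .true | equal e | .true  | less p    = bottom e xa p
  ... | .true | equal e | .false | notLess p = right (≤-antisym ax p) yb (subst (_< yh) (sym e) yl<yh)
  ... | .false | unequal e | _ | _ with a ≡ᵇ xh | eq-view a xh | b <ᵇ yh | lt-view b yh
  ...   | .true | equal e₂ | .true  | less p    = right e₂ yb p
  ...   | .true | equal e₂ | .false | notLess p = top (≤-antisym by p) (subst (xl <_) (sym e₂) xl<xh) ax
  ...   | .false | unequal e₂ | _ | _ with sd
  ...     | inj₁ (inj₂ q) = ⊥-elim (e₂ q)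
  ...     | inj₂ (inj₁ q) = ⊥-elim (e q)
  ...     | inj₁ (inj₁ q) = left q (≤∧≢⇒< yb (λ z → e (sym z))) by
  ...     | inj₂ (inj₂ q) with xl <ᵇ a | lt-view xl a
  ...       | .true  | less p    = top q p ax
  ...       | .false | notLess p = left (≤-antisym p xa) (subst (yl <_) (sym q) yl<yh) by

  Side⇒Bd : ∀ {w} → Side w → Bd w
  Side⇒Bd (bottom refl p q) = ((p , <⇒≤ q) , (≤-refl , <⇒≤ yl<yh)) , inj₂ (inj₁ refl)
  Side⇒Bd (right refl p q)  = ((<⇒≤ xl<xh , ≤-refl) , (p , <⇒≤ q)) , inj₁ (inj₂ refl)
  Side⇒Bd (top refl p q)    = ((<⇒≤ p , q) , (<⇒≤ yl<yh , ≤-refl)) , inj₂ (inj₂ refl)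
  Side⇒Bd (left refl p q)   = ((≤-refl , <⇒≤ xl<xh) , (<⇒≤ p , q)) , inj₁ (inj₁ refl)

  ccw-onSide : ∀ {a b} (s : Side (a , b)) →
               ccw t i j (a , b) ≡ onSide s (suc a , b) (a , suc b) (a ∸ 1 , b) (a , b ∸ 1)
  ccw-onSide s = trans (ccw-bySide _) (bySide-onSide s _ _ _ _)

  ccw-Bd : ∀ w → Bd w → Bd (ccw t i j w)
  ccw-Bd (a , b) bw = subst Bd (sym (ccw-onSide s)) (step s)
    where
    s : Side (a , b)
    s = side-of bw
    step : (s : Side (a , b)) → Bd (onSide s (suc a , b) (a , suc b) (a ∸ 1 , b) (a , b ∸ 1))
    step (bottom refl p q) with m≤n⇒m<n∨m≡n q
    ... | inj₁ q' = Side⇒Bd (bottom refl (≤-trans p (n≤1+n a)) q')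
    ... | inj₂ q' = Side⇒Bd (right q' ≤-refl yl<yh)
    step (right refl p q) with m≤n⇒m<n∨m≡n q
    ... | inj₁ q' = Side⇒Bd (right refl (≤-trans p (n≤1+n b)) q')
    ... | inj₂ q' = Side⇒Bd (top q' xl<xh ≤-refl)
    step (top {suc a'} refl p q) with m≤n⇒m<n∨m≡n (s≤s⁻¹ p)
    ... | inj₁ p'   = Side⇒Bd (top refl p' (<⇒≤ q))
    ... | inj₂ refl = Side⇒Bd (left refl yl<yh ≤-refl)
    step (left {b = suc b'} refl p q) with m≤n⇒m<n∨m≡n (s≤s⁻¹ p)
    ... | inj₁ p'   = Side⇒Bd (left refl p' (<⇒≤ q))
    ... | inj₂ refl = Side⇒Bd (bottom refl ≤-refl xl<xh)

  private
    ∸1-injective : ∀ {a a'} → 0 < a → 0 < a' → a ∸ 1 ≡ a' ∸ 1 → a ≡ a'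
    ∸1-injective {suc a} {suc a'} _ _ e = cong suc e

    ∸1-< : ∀ {m a} → m < a → a ∸ 1 < a
    ∸1-< {a = suc a} _ = ≤-refl

    positive : ∀ {m a} → m < a → 0 < a
    positive p = ≤-trans (s≤s z≤n) p

  ccw-injective : ∀ w w' → Bd w → Bd w' → ccw t i j w ≡ ccw t i j w' → w ≡ w'
  ccw-injective (a , b) (a' , b') bw bw' e =
    sidewise (side-of bw) (side-of bw') (trans (sym (ccw-onSide (side-of bw))) (trans e (ccw-onSide (side-of bw'))))
    where
    sidewise : (s : Side (a , b)) (s' : Side (a' , b')) →
         onSide s (suc a , b) (a , suc b) (a ∸ 1 , b) (a , b ∸ 1) ≡
         onSide s' (suc a' , b') (a' , suc b') (a' ∸ 1 , b') (a' , b' ∸ 1) →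
         (a , b) ≡ (a' , b')
    sidewise (bottom refl p q) (bottom refl p' q') e = cong (_, yl) (suc-injective (cong proj₁ e))
    sidewise (bottom refl p q) (right refl p' q')  e = ⊥-elim (<⇒≢ (s≤s p') (cong proj₂ e))
    sidewise (bottom refl p q) (top refl p' q')    e = ⊥-elim (<⇒≢ yl<yh (cong proj₂ e))
    sidewise (bottom refl p q) (left refl p' q')   e = ⊥-elim (<⇒≢ (s≤s p) (sym (cong proj₁ e)))
    sidewise (right refl p q)  (bottom refl p' q') e = ⊥-elim (<⇒≢ (s≤s p) (sym (cong proj₂ e)))
    sidewise (right refl p q)  (right refl p' q')  e = cong (xh ,_) (suc-injective (cong proj₂ e))
    sidewise (right refl p q)  (top refl p' q')    e = ⊥-elim (<⇒≢ (≤-trans (∸1-< p') q') (sym (cong proj₁ e)))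
    sidewise (right refl p q)  (left refl p' q')   e = ⊥-elim (<⇒≢ xl<xh (sym (cong proj₁ e)))
    sidewise (top refl p q)    (bottom refl p' q') e = ⊥-elim (<⇒≢ yl<yh (sym (cong proj₂ e)))
    sidewise (top refl p q)    (right refl p' q')  e = ⊥-elim (<⇒≢ (≤-trans (∸1-< p) q) (cong proj₁ e))
    sidewise (top refl p q)    (top refl p' q')    e = cong (_, yh) (∸1-injective (positive p) (positive p') (cong proj₁ e))
    sidewise (top refl p q)    (left refl p' q')   e = ⊥-elim (<⇒≢ (≤-trans (∸1-< p') q') (sym (cong proj₂ e)))
    sidewise (left refl p q)   (bottom refl p' q') e = ⊥-elim (<⇒≢ (s≤s p') (cong proj₁ e))
    sidewise (left refl p q)   (right refl p' q')  e = ⊥-elim (<⇒≢ xl<xh (cong proj₁ e))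
    sidewise (left refl p q)   (top refl p' q')    e = ⊥-elim (<⇒≢ (≤-trans (∸1-< p) q) (cong proj₂ e))
    sidewise (left refl p q)   (left refl p' q')   e = cong (xl ,_) (∸1-injective (positive p) (positive p') (cong proj₂ e))

  ccw^-Bd : ∀ n w → Bd w → Bd (ccw^ t i j n w)
  ccw^-Bd zero    w bw = bw
  ccw^-Bd (suc n) w bw = ccw-Bd _ (ccw^-Bd n w bw)

  ccw^-+ : ∀ m n w → ccw^ t i j (m + n) w ≡ ccw^ t i j m (ccw^ t i j n w)
  ccw^-+ zero    n w = refl
  ccw^-+ (suc m) n w = cong (ccw t i j) (ccw^-+ m n w)

  ccw^-injective : ∀ n w w' → Bd w → Bd w' → ccw^ t i j n w ≡ ccw^ t i j n w' → w ≡ w'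
  ccw^-injective zero    w w' bw bw' e = e
  ccw^-injective (suc n) w w' bw bw' e =
    ccw^-injective n w w' bw bw' (ccw-injective _ _ (ccw^-Bd n w bw) (ccw^-Bd n w' bw') e)

  Exp : Point → Point → ℕ → Set
  Exp = Exponent t i j

  exponent-zero : ∀ x → Exp x x 0
  exponent-zero x = refl , (λ n' ())

  exponent-unique : ∀ {v w n n'} → Exp v w n → Exp v w n' → n ≡ n'
  exponent-unique {n = n} {n'} (e , min) (e' , min') with <-cmp n n'
  ... | tri< n<n' _ _ = ⊥-elim (min' n n<n' e)
  ... | tri≈ _ n≡n' _ = n≡n'
  ... | tri> _ _ n'<n = ⊥-elim (min n' n'<n e')

  -- Before reaching γ (exponent n), the orbit of a boundary point x hits
  -- any point E at most once, namely at E's own exponent: a repetition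
  -- would make the orbit periodic with a period short enough to reach γ
  -- earlier.
  exponent-first-visit : ∀ {x γ E n e} → Bd x → Exp x γ n → Exp x E e →
                         ∀ k → 1 ≤ k → k ≤ n → ccw^ t i j k x ≡ E → k ≡ e
  exponent-first-visit {x} {γ} {E} {n} {e} bx (γ≡ , γ-min) (E≡ , E-min) k 1≤k k≤n hit with <-cmp k e
  ... | tri< k<e _ _ = ⊥-elim (E-min k k<e hit)
  ... | tri≈ _ k≡e _ = k≡e
  ... | tri> _ _ e<k = ⊥-elim (γ-min (n ∸ d) (∸-monoʳ-< {n} {d} {0} (m<n⇒0<n∸m e<k) d≤n) γ-earlier)
    where
    d : ℕ
    d = k ∸ e
    d≤n : d ≤ n
    d≤n = ≤-trans (m∸n≤m k e) k≤n
    periodic : ccw^ t i j d x ≡ x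
    periodic = ccw^-injective e (ccw^ t i j d x) x (ccw^-Bd d x bx) bx (begin
      ccw^ t i j e (ccw^ t i j d x) ≡⟨ ccw^-+ e d x ⟨
      ccw^ t i j (e + d) x          ≡⟨ cong (λ n → ccw^ t i j n x) (m+[n∸m]≡n (<⇒≤ e<k)) ⟩
      ccw^ t i j k x                ≡⟨ trans hit (sym E≡) ⟩
      ccw^ t i j e x                ∎)
    γ-earlier : ccw^ t i j (n ∸ d) x ≡ γ
    γ-earlier = begin
      ccw^ t i j (n ∸ d) x                 ≡⟨ cong (ccw^ t i j (n ∸ d)) periodic ⟨
      ccw^ t i j (n ∸ d) (ccw^ t i j d x)  ≡⟨ ccw^-+ (n ∸ d) d x ⟨
      ccw^ t i j (n ∸ d + d) x             ≡⟨ cong (λ m → ccw^ t i j m x) (m∸n+n≡m d≤n) ⟩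
      ccw^ t i j n x                       ≡⟨ γ≡ ⟩
      γ                                    ∎

  -- The counter-clockwise order of boundary points, starting at the
  -- bottom-left corner, and how it changes along ccw.

  sideIndex : Point → ℕ
  sideIndex w = bySide w 0 1 2 3

  sameSide≼ : Point → Point → Bool
  sameSide≼ (c , r) (a , b) = bySide (a , b) (c <ᵇ suc a) (r <ᵇ suc b) (a <ᵇ suc c) (b <ᵇ suc r)

  precedes : Point → Point → Bool
  precedes E w = (sideIndex E <ᵇ sideIndex w) ∨ ((sideIndex E ≡ᵇ sideIndex w) ∧ sameSide≼ E w)

  precedesˢ : ∀ {c r a b} → Side (c , r) → Side (a , b) → Bool
  precedesˢ {c = c} {a = a} (bottom _ _ _) (bottom _ _ _) = c <ᵇ suc a
  precedesˢ (bottom _ _ _) (right _ _ _)  = true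
  precedesˢ (bottom _ _ _) (top _ _ _)    = true
  precedesˢ (bottom _ _ _) (left _ _ _)   = true
  precedesˢ (right _ _ _)  (bottom _ _ _) = false
  precedesˢ {r = r} {b = b} (right _ _ _) (right _ _ _) = r <ᵇ suc b
  precedesˢ (right _ _ _)  (top _ _ _)    = true
  precedesˢ (right _ _ _)  (left _ _ _)   = true
  precedesˢ (top _ _ _)    (bottom _ _ _) = false
  precedesˢ (top _ _ _)    (right _ _ _)  = false
  precedesˢ {c = c} {a = a} (top _ _ _) (top _ _ _) = a <ᵇ suc c
  precedesˢ (top _ _ _)    (left _ _ _)   = true
  precedesˢ (left _ _ _)   (bottom _ _ _) = false
  precedesˢ (left _ _ _)   (right _ _ _)  = false
  precedesˢ (left _ _ _)   (top _ _ _)    = false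
  precedesˢ {r = r} {b = b} (left _ _ _) (left _ _ _) = b <ᵇ suc r

  precedes-onSide : ∀ {c r a b} (sE : Side (c , r)) (sw : Side (a , b)) →
                    precedes (c , r) (a , b) ≡ precedesˢ sE sw
  precedes-onSide {c} {r} {a} {b} sE sw
    rewrite bySide-onSide sE 0 1 2 3 | bySide-onSide sw 0 1 2 3
          | bySide-onSide sw (c <ᵇ suc a) (r <ᵇ suc b) (a <ᵇ suc c) (b <ᵇ suc r) with sE | sw
  ... | bottom _ _ _ | bottom _ _ _ = refl
  ... | bottom _ _ _ | right _ _ _  = refl
  ... | bottom _ _ _ | top _ _ _    = refl
  ... | bottom _ _ _ | left _ _ _   = refl
  ... | right _ _ _  | bottom _ _ _ = refl
  ... | right _ _ _  | right _ _ _  = refl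
  ... | right _ _ _  | top _ _ _    = refl
  ... | right _ _ _  | left _ _ _   = refl
  ... | top _ _ _    | bottom _ _ _ = refl
  ... | top _ _ _    | right _ _ _  = refl
  ... | top _ _ _    | top _ _ _    = refl
  ... | top _ _ _    | left _ _ _   = refl
  ... | left _ _ _   | bottom _ _ _ = refl
  ... | left _ _ _   | right _ _ _  = refl
  ... | left _ _ _   | top _ _ _    = refl
  ... | left _ _ _   | left _ _ _   = refl

  pointEqᵇ : Point → Point → Bool
  pointEqᵇ (c , r) (a , b) = (c ≡ᵇ a) ∧ (r ≡ᵇ b)

  precedes-bottom : ∀ c r a (sE : Side (c , r)) (p : xl ≤ a) (q : suc a < xh) →
    precedesˢ sE (bottom {suc a} refl (≤-trans p (n≤1+n a)) q) ≡
    precedesˢ sE (bottom {a} refl p (<-trans (n<1+n a) q)) xor pointEqᵇ (c , r) (suc a , yl)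
  precedes-bottom c r a (bottom refl _ _) p q rewrite ≡ᵇ-refl yl | ∧-identityʳ (c ≡ᵇ suc a) = <ᵇ-sucʳ c (suc a)
  precedes-bottom c r a (right refl _ _)  p q rewrite ≡ᵇ-false xh (suc a) (>⇒≢ q) = refl
  precedes-bottom c r a (top refl _ _)    p q rewrite ≡ᵇ-false yh yl (>⇒≢ yl<yh) | ∧-zeroʳ (c ≡ᵇ suc a) = refl
  precedes-bottom c r a (left refl _ _)   p q rewrite ≡ᵇ-false xl (suc a) (<⇒≢ (s≤s p)) = refl

  precedes-bottom-corner : ∀ c r a (sE : Side (c , r)) (p : xl ≤ a) (q : suc a ≡ xh) →
    precedesˢ sE (right {suc a} q ≤-refl yl<yh) ≡
    precedesˢ sE (bottom {a} refl p (subst (a <_) q ≤-refl)) xor pointEqᵇ (c , r) (suc a , yl)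
  precedes-bottom-corner c r a (bottom refl c1 c2) p q
    rewrite ≡ᵇ-refl yl | <ᵇ-true c (suc a) (subst (c <_) (sym q) c2)
          | ≡ᵇ-false c (suc a) (λ e → <⇒≢ c2 (trans e q)) = refl
  precedes-bottom-corner c r a (right refl c1 _) p q rewrite ≡ᵇ-true xh (suc a) (sym q) = <ᵇ-suc-≥ r yl c1
  precedes-bottom-corner c r a (top refl _ _)    p q rewrite ≡ᵇ-false yh yl (>⇒≢ yl<yh) | ∧-zeroʳ (c ≡ᵇ suc a) = refl
  precedes-bottom-corner c r a (left refl _ _)   p q rewrite ≡ᵇ-false xl (suc a) (<⇒≢ (s≤s p)) = refl

  precedes-right : ∀ c r b (sE : Side (c , r)) (p : yl ≤ b) (q : suc b < yh) →
    precedesˢ sE (right {xh} {suc b} refl (≤-trans p (n≤1+n b)) q) ≡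
    precedesˢ sE (right {xh} {b} refl p (<-trans (n<1+n b) q)) xor pointEqᵇ (c , r) (xh , suc b)
  precedes-right c r b (bottom refl _ c2) p q rewrite ≡ᵇ-false c xh (<⇒≢ c2) = refl
  precedes-right c r b (right refl _ _)   p q rewrite ≡ᵇ-refl xh = <ᵇ-sucʳ r (suc b)
  precedes-right c r b (top refl _ _)     p q rewrite ≡ᵇ-false yh (suc b) (>⇒≢ q) | ∧-zeroʳ (c ≡ᵇ xh) = refl
  precedes-right c r b (left refl _ _)    p q rewrite ≡ᵇ-false xl xh (<⇒≢ xl<xh) = refl

  precedes-right-corner : ∀ c r b (sE : Side (c , r)) (p : yl ≤ b) (q : suc b ≡ yh) →
    precedesˢ sE (top {xh} {suc b} q xl<xh ≤-refl) ≡
    precedesˢ sE (right {xh} {b} refl p (subst (b <_) q ≤-refl)) xor pointEqᵇ (c , r) (xh , suc b)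
  precedes-right-corner c r b (bottom refl _ c2) p q rewrite ≡ᵇ-false c xh (<⇒≢ c2) = refl
  precedes-right-corner c r b (right refl _ c2) p q
    rewrite ≡ᵇ-refl xh | <ᵇ-true r (suc b) (subst (r <_) (sym q) c2)
          | ≡ᵇ-false r (suc b) (λ e → <⇒≢ c2 (trans e q)) = refl
  precedes-right-corner c r b (top refl _ c2) p q
    rewrite ≡ᵇ-true yh (suc b) (sym q) | ∧-identityʳ (c ≡ᵇ xh) = <ᵇ-suc-≤ c xh c2
  precedes-right-corner c r b (left refl _ _) p q rewrite ≡ᵇ-false xl xh (<⇒≢ xl<xh) = refl

  precedes-top : ∀ c r a (sE : Side (c , r)) (p : xl < a) (q : suc a ≤ xh) →
    precedesˢ sE (top {a} {yh} refl p (<⇒≤ q)) ≡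
    precedesˢ sE (top {suc a} {yh} refl (<-trans p (n<1+n a)) q) xor pointEqᵇ (c , r) (a , yh)
  precedes-top c r a (bottom refl _ _) p q rewrite ≡ᵇ-false yl yh (<⇒≢ yl<yh) | ∧-zeroʳ (c ≡ᵇ a) = refl
  precedes-top c r a (right refl _ _)  p q rewrite ≡ᵇ-false xh a (>⇒≢ q) = refl
  precedes-top c r a (top refl _ _)    p q
    rewrite ≡ᵇ-refl yh | ∧-identityʳ (c ≡ᵇ a) = trans (<ᵇ-sucʳ a c) (cong ((a <ᵇ c) xor_) (≡ᵇ-sym a c))
  precedes-top c r a (left refl _ _)   p q rewrite ≡ᵇ-false xl a (<⇒≢ p) = refl

  precedes-top-corner : ∀ c r (sE : Side (c , r)) (q : suc xl ≤ xh) →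
    precedesˢ sE (left {xl} {yh} refl yl<yh ≤-refl) ≡
    precedesˢ sE (top {suc xl} {yh} refl ≤-refl q) xor pointEqᵇ (c , r) (xl , yh)
  precedes-top-corner c r (bottom refl _ _) q rewrite ≡ᵇ-false yl yh (<⇒≢ yl<yh) | ∧-zeroʳ (c ≡ᵇ xl) = refl
  precedes-top-corner c r (right refl _ _)  q rewrite ≡ᵇ-false xh xl (>⇒≢ xl<xh) = refl
  precedes-top-corner c r (top refl c1 _)   q rewrite ≡ᵇ-false c xl (>⇒≢ c1) | <ᵇ-true xl c c1 = refl
  precedes-top-corner c r (left refl _ c2)  q rewrite ≡ᵇ-refl xl = <ᵇ-suc-≤ r yh c2

  precedes-left : ∀ c r b (sE : Side (c , r)) (p : yl < b) (q : suc b ≤ yh) →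
    precedesˢ sE (left {xl} {b} refl p (<⇒≤ q)) ≡
    precedesˢ sE (left {xl} {suc b} refl (<-trans p (n<1+n b)) q) xor pointEqᵇ (c , r) (xl , b)
  precedes-left c r b (bottom refl _ _) p q rewrite ≡ᵇ-false yl b (<⇒≢ p) | ∧-zeroʳ (c ≡ᵇ xl) = refl
  precedes-left c r b (right refl _ _)  p q rewrite ≡ᵇ-false xh xl (>⇒≢ xl<xh) = refl
  precedes-left c r b (top refl c1 _)   p q rewrite ≡ᵇ-false c xl (>⇒≢ c1) = refl
  precedes-left c r b (left refl _ _)   p q
    rewrite ≡ᵇ-refl xl = trans (<ᵇ-sucʳ b r) (cong ((b <ᵇ r) xor_) (≡ᵇ-sym b r))

  -- the step from the last boundary point back to the first one wraps around
  precedes-left-corner : ∀ c r (sE : Side (c , r)) (q : suc yl ≤ yh) →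
    precedesˢ sE (bottom {xl} {yl} refl ≤-refl xl<xh) ≡
    (precedesˢ sE (left {xl} {suc yl} refl ≤-refl q) xor pointEqᵇ (c , r) (xl , yl)) xor true
  precedes-left-corner c r (bottom refl c1 _) q
    rewrite ≡ᵇ-refl yl | ∧-identityʳ (c ≡ᵇ xl) | <ᵇ-suc-≤ xl c c1 | ≡ᵇ-sym xl c with c ≡ᵇ xl
  ... | true  = refl
  ... | false = refl
  precedes-left-corner c r (right refl _ _) q rewrite ≡ᵇ-false xh xl (>⇒≢ xl<xh) = refl
  precedes-left-corner c r (top refl _ _)   q rewrite ≡ᵇ-false yh yl (>⇒≢ yl<yh) | ∧-zeroʳ (c ≡ᵇ xl) = refl
  precedes-left-corner c r (left refl c1 _) q
    rewrite ≡ᵇ-false r yl (>⇒≢ c1) | <ᵇ-true yl r c1 | ∧-zeroʳ (xl ≡ᵇ xl) = refl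

  -- w is the last boundary point, the one just before the bottom-left corner
  isLast : Point → Bool
  isLast (a , b) = bySide (a , b) false false false (b ≡ᵇ suc yl)

  precedes-via-sides : ∀ {E w w'} (sE : Side E) (s : Side w) (s' : Side w') (last : Bool) →
    isLast w ≡ last → precedesˢ sE s' ≡ (precedesˢ sE s xor pointEqᵇ E w') xor last →
    precedes E w' ≡ (precedes E w xor pointEqᵇ E w') xor isLast w
  precedes-via-sides {E} {w} {w'} sE s s' last isLast≡ sidewise = begin
    precedes E w'                                  ≡⟨ precedes-onSide sE s' ⟩
    precedesˢ sE s'                                ≡⟨ sidewise ⟩
    (precedesˢ sE s xor pointEqᵇ E w') xor last    ≡⟨ cong₂ (λ u l → (u xor pointEqᵇ E w') xor l)
                                                            (sym (precedes-onSide sE s)) (sym isLast≡) ⟩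
    (precedes E w xor pointEqᵇ E w') xor isLast w  ∎

  precedes-ccw-sides : ∀ {c r a b} (sE : Side (c , r)) (s : Side (a , b)) →
    let w' = onSide s (suc a , b) (a , suc b) (a ∸ 1 , b) (a , b ∸ 1) in
    precedes (c , r) w' ≡ (precedes (c , r) (a , b) xor pointEqᵇ (c , r) w') xor isLast (a , b)
  precedes-ccw-sides {c} {r} {a} sE (bottom refl p q) with m≤n⇒m<n∨m≡n q
  ... | inj₁ q' = precedes-via-sides sE s (bottom refl (≤-trans p (n≤1+n a)) q') false (bySide-onSide s _ _ _ _)
                    (trans (precedes-bottom c r a sE p q') (sym (xor-identityʳ _)))
    where
    s : Side (a , yl)
    s = bottom refl p (<-trans (n<1+n a) q')
  ... | inj₂ q' = precedes-via-sides sE s (right q' ≤-refl yl<yh) false (bySide-onSide s _ _ _ _)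
                    (trans (precedes-bottom-corner c r a sE p q') (sym (xor-identityʳ _)))
    where
    s : Side (a , yl)
    s = bottom refl p (subst (a <_) q' ≤-refl)
  precedes-ccw-sides {c} {r} {b = b} sE (right refl p q) with m≤n⇒m<n∨m≡n q
  ... | inj₁ q' = precedes-via-sides sE s (right refl (≤-trans p (n≤1+n b)) q') false (bySide-onSide s _ _ _ _)
                    (trans (precedes-right c r b sE p q') (sym (xor-identityʳ _)))
    where
    s : Side (xh , b)
    s = right refl p (<-trans (n<1+n b) q')
  ... | inj₂ q' = precedes-via-sides sE s (top q' xl<xh ≤-refl) false (bySide-onSide s _ _ _ _)
                    (trans (precedes-right-corner c r b sE p q') (sym (xor-identityʳ _)))
    where
    s : Side (xh , b)
    s = right refl p (subst (b <_) q' ≤-refl)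
  precedes-ccw-sides {c} {r} sE (top {suc a'} refl p q) with m≤n⇒m<n∨m≡n (s≤s⁻¹ p)
  ... | inj₁ p'   = precedes-via-sides sE s (top refl p' (<⇒≤ q)) false (bySide-onSide s _ _ _ _)
                      (trans (precedes-top c r a' sE p' q) (sym (xor-identityʳ _)))
    where
    s : Side (suc a' , yh)
    s = top refl (<-trans p' (n<1+n a')) q
  ... | inj₂ refl = precedes-via-sides sE s (left refl yl<yh ≤-refl) false (bySide-onSide s _ _ _ _)
                      (trans (precedes-top-corner c r sE q) (sym (xor-identityʳ _)))
    where
    s : Side (suc a' , yh)
    s = top refl ≤-refl q
  precedes-ccw-sides {c} {r} sE (left {b = suc b'} refl p q) with m≤n⇒m<n∨m≡n (s≤s⁻¹ p)
  ... | inj₁ p'   = precedes-via-sides sE s (left refl p' (<⇒≤ q)) false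
                      (trans (bySide-onSide s _ _ _ _) (≡ᵇ-false b' yl (>⇒≢ p')))
                      (trans (precedes-left c r b' sE p' q) (sym (xor-identityʳ _)))
    where
    s : Side (xl , suc b')
    s = left refl (<-trans p' (n<1+n b')) q
  ... | inj₂ refl = precedes-via-sides sE s (bottom refl ≤-refl xl<xh) true
                      (trans (bySide-onSide s _ _ _ _) (≡ᵇ-refl yl))
                      (precedes-left-corner c r sE q)
    where
    s : Side (xl , suc b')
    s = left refl ≤-refl q

  precedes-ccw : ∀ E w → Bd E → Bd w →
                 precedes E (ccw t i j w) ≡ (precedes E w xor pointEqᵇ E (ccw t i j w)) xor isLast w
  precedes-ccw E (a , b) bE bw =
    subst (λ w' → precedes E w' ≡ (precedes E (a , b) xor pointEqᵇ E w') xor isLast (a , b))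
          (sym (ccw-onSide (side-of bw))) (precedes-ccw-sides (side-of bE) (side-of bw))

  pointEqᵇ-refl : ∀ w → pointEqᵇ w w ≡ true
  pointEqᵇ-refl (a , b) rewrite ≡ᵇ-refl a | ≡ᵇ-refl b = refl

  pointEqᵇ-false : ∀ E w → E ≢ w → pointEqᵇ E w ≡ false
  pointEqᵇ-false (c , r) (a , b) E≢w with c ≡ᵇ a | eq-view c a
  ... | .false | unequal _ = refl
  ... | .true  | equal refl rewrite ≡ᵇ-false r b (λ q → E≢w (cong (c ,_) q)) = refl

  -- The arc parity of w: whether exactly one of α, β precedes w, that is,
  -- whether w lies on the boundary arc from one of them to the other.
  arcParity : Point → Point → Point → Bool
  arcParity α β w = precedes α w xor precedes β w

  arcParity-ccw : ∀ α β w → Bd α → Bd β → Bd w →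
                  arcParity α β (ccw t i j w) ≡
                  arcParity α β w xor (pointEqᵇ α (ccw t i j w) xor pointEqᵇ β (ccw t i j w))
  arcParity-ccw α β w bα bβ bw = begin
    arcParity α β w'                                       ≡⟨ cong₂ _xor_ (precedes-ccw α w bα bw) (precedes-ccw β w bβ bw) ⟩
    ((precedes α w xor hα) xor isLast w) xor ((precedes β w xor hβ) xor isLast w)
                                                           ≡⟨ xor-interchange (precedes α w xor hα) (isLast w) (precedes β w xor hβ) (isLast w) ⟩
    ((precedes α w xor hα) xor (precedes β w xor hβ)) xor (isLast w xor isLast w)
                                                           ≡⟨ cong (((precedes α w xor hα) xor (precedes β w xor hβ)) xor_) (xor-same (isLast w)) ⟩
    ((precedes α w xor hα) xor (precedes β w xor hβ)) xor false
                                                           ≡⟨ xor-identityʳ _ ⟩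
    (precedes α w xor hα) xor (precedes β w xor hβ)        ≡⟨ xor-interchange (precedes α w) hα (precedes β w) hβ ⟩
    arcParity α β w xor (hα xor hβ)                        ∎
    where
    w' : Point
    w' = ccw t i j w
    hα hβ : Bool
    hα = pointEqᵇ α w'
    hβ = pointEqᵇ β w'

  visits : Point → Point → ℕ → Bool
  visits E x zero    = false
  visits E x (suc n) = visits E x n xor pointEqᵇ E (ccw^ t i j (suc n) x)

  arcParity-ccw^ : ∀ α β x → Bd α → Bd β → Bd x → ∀ n →
                   arcParity α β (ccw^ t i j n x) ≡ arcParity α β x xor (visits α x n xor visits β x n)
  arcParity-ccw^ α β x bα bβ bx zero = sym (xor-identityʳ _)
  arcParity-ccw^ α β x bα bβ bx (suc n) = begin
    arcParity α β (ccw t i j (ccw^ t i j n x))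
      ≡⟨ arcParity-ccw α β (ccw^ t i j n x) bα bβ (ccw^-Bd n x bx) ⟩
    arcParity α β (ccw^ t i j n x) xor (hα xor hβ)
      ≡⟨ cong (_xor (hα xor hβ)) (arcParity-ccw^ α β x bα bβ bx n) ⟩
    (arcParity α β x xor (visits α x n xor visits β x n)) xor (hα xor hβ)
      ≡⟨ xor-assoc (arcParity α β x) _ _ ⟩
    arcParity α β x xor ((visits α x n xor visits β x n) xor (hα xor hβ))
      ≡⟨ cong (arcParity α β x xor_) (xor-interchange (visits α x n) (visits β x n) hα hβ) ⟩
    arcParity α β x xor (visits α x (suc n) xor visits β x (suc n)) ∎
    where
    hα hβ : Bool
    hα = pointEqᵇ α (ccw^ t i j (suc n) x)
    hβ = pointEqᵇ β (ccw^ t i j (suc n) x)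

  visits-exponent : ∀ {x E e} → Exp x E e → ∀ n →
                    (∀ k → 1 ≤ k → k ≤ n → ccw^ t i j k x ≡ E → k ≡ e) → visits E x n ≡ inRange e n
  visits-exponent {e = zero}  _ zero _ = refl
  visits-exponent {e = suc e} _ zero _ = refl
  visits-exponent {x} {E} {e} xE (suc n) only-at-e with suc n ≟ e
  ... | yes refl = begin
    visits E x n xor pointEqᵇ E (ccw^ t i j (suc n) x)
      ≡⟨ cong₂ _xor_ (visits-exponent xE n earlier) (trans (cong (pointEqᵇ E) (proj₁ xE)) (pointEqᵇ-refl E)) ⟩
    inRange (suc n) n xor true ≡⟨ inRange-hit n ⟨
    inRange (suc n) (suc n)    ∎
    where
    earlier : ∀ k → 1 ≤ k → k ≤ n → ccw^ t i j k x ≡ E → k ≡ e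
    earlier = λ k 1≤k k≤n → only-at-e k 1≤k (≤-trans k≤n (n≤1+n n))
  ... | no 1+n≢e = begin
    visits E x n xor pointEqᵇ E (ccw^ t i j (suc n) x)
      ≡⟨ cong₂ _xor_ (visits-exponent xE n earlier) (pointEqᵇ-false E _ (λ q → 1+n≢e (only-at-e (suc n) (s≤s z≤n) ≤-refl (sym q)))) ⟩
    inRange e n xor false      ≡⟨ xor-identityʳ _ ⟩
    inRange e n                ≡⟨ inRange-suc e n (λ q → 1+n≢e (sym q)) ⟨
    inRange e (suc n)          ∎
    where
    earlier : ∀ k → 1 ≤ k → k ≤ n → ccw^ t i j k x ≡ E → k ≡ e
    earlier = λ k 1≤k k≤n → only-at-e k 1≤k (≤-trans k≤n (n≤1+n n))

  arcParity-exponent : ∀ {α β x w eα eβ n} → Bd α → Bd β → Bd x →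
                       Exp x α eα → Exp x β eβ → Exp x w n →
                       arcParity α β w ≡ arcParity α β x xor (inRange eα n xor inRange eβ n)
  arcParity-exponent {α} {β} {x} {w} {eα} {eβ} {n} bα bβ bx xα xβ xw = begin
    arcParity α β w                                             ≡⟨ cong (arcParity α β) (proj₁ xw) ⟨
    arcParity α β (ccw^ t i j n x)                              ≡⟨ arcParity-ccw^ α β x bα bβ bx n ⟩
    arcParity α β x xor (visits α x n xor visits β x n)         ≡⟨ cong (arcParity α β x xor_)
                                                                     (cong₂ _xor_ (visits-exponent xα n (exponent-first-visit bx xw xα))
                                                                                  (visits-exponent xβ n (exponent-first-visit bx xw xβ))) ⟩
    arcParity α β x xor (inRange eα n xor inRange eβ n)         ∎

  Step : Point → Point → Set
  Step u v = Adjacent u v × Sq u × Sq v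

  Walk : Point → Point → Set
  Walk = Star Step

  Adjacent-sym : ∀ {u v} → Adjacent u v → Adjacent v u
  Adjacent-sym (inj₁ (e , inj₁ p)) = inj₁ (sym e , inj₂ p)
  Adjacent-sym (inj₁ (e , inj₂ p)) = inj₁ (sym e , inj₁ p)
  Adjacent-sym (inj₂ (e , inj₁ p)) = inj₂ (sym e , inj₂ p)
  Adjacent-sym (inj₂ (e , inj₂ p)) = inj₂ (sym e , inj₁ p)

  Step-sym : ∀ {u v} → Step u v → Step v u
  Step-sym (adj , su , sv) = Adjacent-sym adj , sv , su

  ∉-start : ∀ {u v z} (W : Walk u v) → ¬ z ∈ₚ W → u ≢ z
  ∉-start W z∉ refl = z∉ (∈-start W)

  -- Ray parity. The ray from (a , k - ½) runs to the right; a walk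
  -- crosses it with each vertical step between rows k - 1 and k in a
  -- column c > a.

  crossesRay : ∀ {u v} → Adjacent u v → ℕ → ℕ → Bool
  crossesRay {c , y} (inj₁ (_ , inj₁ _)) a k = (a <ᵇ c) ∧ (suc y ≡ᵇ k)
  crossesRay {c , y} (inj₁ (_ , inj₂ _)) a k = (a <ᵇ c) ∧ (y ≡ᵇ k)
  crossesRay (inj₂ _) a k = false

  rayParity : ∀ {u v} → Walk u v → ℕ → ℕ → Bool
  rayParity ε                 a k = false
  rayParity ((adj , _) ◅ W) a k = crossesRay adj a k xor rayParity W a k

  rightOf : Point → ℕ → ℕ → Bool
  rightOf (c , r) a k = (a <ᵇ c) ∧ (r ≡ᵇ k)

  -- a horizontal step lies on one row and can only enter or leave the
  -- part of that row right of a by passing through (a , k)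
  rightOf-horizontal : ∀ c y a k → (c , y) ≢ (a , k) → rightOf (c , y) a k ≡ rightOf (suc c , y) a k
  rightOf-horizontal c y a k ≢ with y ≡ᵇ k | eq-view y k
  ... | .false | unequal _ rewrite ∧-zeroʳ (a <ᵇ c) | ∧-zeroʳ (a <ᵇ suc c) = refl
  ... | .true  | equal refl with a <ᵇ c | lt-view a c | a <ᵇ suc c | lt-view a (suc c)
  ...   | .true  | less _    | .true  | less _    = refl
  ...   | .false | notLess _ | .false | notLess _ = refl
  ...   | .true  | less p    | .false | notLess q = ⊥-elim (<⇒≱ (≤-trans p (n≤1+n c)) q)
  ...   | .false | notLess p | .true  | less q    = ⊥-elim (≢ (cong (_, y) (≤-antisym p (s≤s⁻¹ q))))

  crossesRay-raise : ∀ {u v} (adj : Adjacent u v) a k → u ≢ (a , k) → v ≢ (a , k) →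
                     crossesRay adj a k xor crossesRay adj a (suc k) ≡ rightOf u a k xor rightOf v a k
  crossesRay-raise {c , y} (inj₁ (refl , inj₁ refl)) a k _ _ = xor-comm ((a <ᵇ c) ∧ (suc y ≡ᵇ k)) ((a <ᵇ c) ∧ (y ≡ᵇ k))
  crossesRay-raise {c , y} (inj₁ (refl , inj₂ refl)) a k _ _ = refl
  crossesRay-raise {c , y} (inj₂ (refl , inj₁ refl)) a k u≢ _ =
    sym (trans (cong (_xor rightOf (suc c , y) a k) (rightOf-horizontal c y a k u≢)) (xor-same (rightOf (suc c , y) a k)))
  crossesRay-raise {v = c , y} (inj₂ (refl , inj₂ refl)) a k _ v≢ =
    sym (trans (cong (rightOf (suc c , y) a k xor_) (rightOf-horizontal c y a k v≢)) (xor-same (rightOf (suc c , y) a k)))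

  -- and so for a whole walk, whose inner vertices cancel out
  rayParity-raise : ∀ {u v} (W : Walk u v) a k → ¬ (a , k) ∈ₚ W →
                    rayParity W a k xor rayParity W a (suc k) ≡ rightOf u a k xor rightOf v a k
  rayParity-raise {u} ε a k _ = sym (xor-same (rightOf u a k))
  rayParity-raise {u} {w} (_◅_ {j = v} (adj , _) W) a k ∉ = begin
    (crossesRay adj a k xor rayParity W a k) xor (crossesRay adj a (suc k) xor rayParity W a (suc k))
      ≡⟨ xor-interchange (crossesRay adj a k) (rayParity W a k) _ _ ⟩
    (crossesRay adj a k xor crossesRay adj a (suc k)) xor (rayParity W a k xor rayParity W a (suc k))
      ≡⟨ cong₂ _xor_ (crossesRay-raise adj a k (λ e → ∉ (inj₁ (sym e))) (∉-start W (∉ ∘ inj₂)))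
                     (rayParity-raise W a k (∉ ∘ inj₂)) ⟩
    (rightOf u a k xor rightOf v a k) xor (rightOf v a k xor rightOf w a k)
      ≡⟨ xor-telescope (rightOf u a k) (rightOf v a k) (rightOf w a k) ⟩
    rightOf u a k xor rightOf w a k ∎

  crossesRay-shift : ∀ {u v} (adj : Adjacent u v) a b → u ≢ (suc a , b) → v ≢ (suc a , b) →
                     crossesRay adj a (suc b) ≡ crossesRay adj (suc a) (suc b)
  crossesRay-shift {c , y} (inj₁ (refl , inj₁ refl)) a b u≢ _ with y ≡ᵇ b | eq-view y b
  ... | .false | unequal _ rewrite ∧-zeroʳ (a <ᵇ c) | ∧-zeroʳ (suc a <ᵇ c) = refl
  ... | .true  | equal refl = cong (_∧ true) (<ᵇ-sucˡ-≢ a c (λ p → u≢ (cong (_, y) p)))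
  crossesRay-shift {v = c , y} (inj₁ (refl , inj₂ refl)) a b _ v≢ with y ≡ᵇ b | eq-view y b
  ... | .false | unequal _ rewrite ∧-zeroʳ (a <ᵇ c) | ∧-zeroʳ (suc a <ᵇ c) = refl
  ... | .true  | equal refl = cong (_∧ true) (<ᵇ-sucˡ-≢ a c (λ p → v≢ (cong (_, y) p)))
  crossesRay-shift (inj₂ _) a b _ _ = refl

  rayParity-shift : ∀ {u v} (W : Walk u v) a b → ¬ (suc a , b) ∈ₚ W →
                    rayParity W a (suc b) ≡ rayParity W (suc a) (suc b)
  rayParity-shift ε a b _ = refl
  rayParity-shift ((adj , _) ◅ W) a b ∉ =
    cong₂ _xor_ (crossesRay-shift adj a b (λ e → ∉ (inj₁ (sym e))) (∉-start W (∉ ∘ inj₂)))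
                (rayParity-shift W a b (∉ ∘ inj₂))

  -- Closing A up
  -- with escape routes from α and β to the outside (up the right side,
  -- or along the top side and then up) gives a curve with both ends
  -- outside the square; the parity of its crossings with the ray from a
  -- point is unchanged by moving that point along a step avoiding A.

  -- parity of the crossings of the ray from (a , b + ½) with the escape
  -- route of the boundary point E
  escape : Point → Point → Bool
  escape (c , r) (a , b) =
    if c ≡ᵇ xh then (r <ᵇ suc b)
    else (if r ≡ᵇ yh then (a <ᵇ c) ∧ (r <ᵇ suc b) else false)

  -- raising the ray past (a , b + 1) meets the escape route only at its
  -- start E, as for walks
  escape-raise : ∀ E a b → Bd E → Sq (a , b) → (a , suc b) ≢ E →
                 escape E (a , b) xor escape E (a , suc b) ≡ rightOf E a (suc b)
  escape-raise (c , r) a b bE sq ≢E with c ≡ᵇ xh | eq-view c xh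
  ... | .true | equal refl rewrite <ᵇ-sucʳ-xor r (suc b) with r ≡ᵇ suc b | eq-view r (suc b)
  ...   | .false | unequal _ = sym (∧-zeroʳ _)
  ...   | .true  | equal refl with a <ᵇ c | lt-view a c
  ...     | .true  | less _    = refl
  ...     | .false | notLess p = ⊥-elim (≢E (cong (_, suc b) (≤-antisym (proj₂ (proj₁ sq)) p)))
  escape-raise (c , r) a b bE sq ≢E | .false | unequal c≢ with r ≡ᵇ yh | eq-view r yh
  ...   | .true | equal refl with a <ᵇ c
  ...     | true  = <ᵇ-sucʳ-xor r (suc b)
  ...     | false = refl
  escape-raise (c , r) a b (_ , side) sq ≢E | .false | unequal c≢ | .false | unequal r≢ with side
  ...     | inj₁ (inj₂ p) = ⊥-elim (c≢ p)
  ...     | inj₂ (inj₂ p) = ⊥-elim (r≢ p)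
  ...     | inj₁ (inj₁ refl) with a <ᵇ c | lt-view a c
  ...       | .false | notLess _ = refl
  ...       | .true  | less p    = ⊥-elim (<⇒≱ p (proj₁ (proj₁ sq)))
  escape-raise (c , r) a b (_ , side) sq ≢E | .false | unequal c≢ | .false | unequal r≢ | inj₂ (inj₁ refl)
    with r ≡ᵇ suc b | eq-view r (suc b)
  ...       | .false | unequal _ = sym (∧-zeroʳ _)
  ...       | .true  | equal p   = ⊥-elim (<⇒≱ (subst (λ z → suc b ≤ z) (sym p) ≤-refl) (proj₁ (proj₂ sq)))

  escape-shift : ∀ E a b → Sq (a , b) → (suc a , b) ≢ E → escape E (a , b) ≡ escape E (suc a , b)
  escape-shift (c , r) a b sq ≢E with c ≡ᵇ xh
  ... | true = refl
  ... | false with r ≡ᵇ yh | eq-view r yh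
  ...   | .false | unequal _ = refl
  ...   | .true  | equal refl with r <ᵇ suc b | lt-view r (suc b)
  ...     | .false | notLess _ rewrite ∧-zeroʳ (a <ᵇ c) | ∧-zeroʳ (suc a <ᵇ c) = refl
  ...     | .true  | less p =
    cong (_∧ true) (<ᵇ-sucˡ-≢ a c (λ q → ≢E (cong₂ _,_ (sym q) (≤-antisym (proj₂ (proj₂ sq)) (s≤s⁻¹ p)))))

  module Separation {α β : Point} (A : Walk α β) (bα : Bd α) (bβ : Bd β) where

    -- crossings of the ray from (a , b + ½) with A and both escape routes
    side : Point → Bool
    side (a , b) = rayParity A a (suc b) xor (escape α (a , b) xor escape β (a , b))

    private
      ≢-endpoints : ∀ {z} → ¬ z ∈ₚ A → z ≢ α × z ≢ β
      ≢-endpoints z∉ = (λ { refl → z∉ (∈-start A) }) , (λ { refl → z∉ (∈-end A) })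

    side-up : ∀ a b → Sq (a , b) → ¬ (a , suc b) ∈ₚ A → side (a , b) ≡ side (a , suc b)
    side-up a b sq ∉ =
      xor-transpose (rayParity A a (suc b)) (rayParity A a (suc (suc b))) _ _
        (begin
          rayParity A a (suc b) xor rayParity A a (suc (suc b))        ≡⟨ rayParity-raise A a (suc b) ∉ ⟩
          rightOf α a (suc b) xor rightOf β a (suc b)                  ≡⟨ cong₂ _xor_
                                                                            (escape-raise α a b bα sq (proj₁ (≢-endpoints ∉)))
                                                                            (escape-raise β a b bβ sq (proj₂ (≢-endpoints ∉))) ⟨
          (escape α (a , b) xor escape α (a , suc b)) xor (escape β (a , b) xor escape β (a , suc b))
                                                                       ≡⟨ xor-interchange (escape α (a , b)) _ _ _ ⟩
          (escape α (a , b) xor escape β (a , b)) xor (escape α (a , suc b) xor escape β (a , suc b)) ∎)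

    side-right : ∀ a b → Sq (a , b) → ¬ (suc a , b) ∈ₚ A → side (a , b) ≡ side (suc a , b)
    side-right a b sq ∉ =
      cong₂ _xor_ (rayParity-shift A a b ∉)
                  (cong₂ _xor_ (escape-shift α a b sq (proj₁ (≢-endpoints ∉)))
                               (escape-shift β a b sq (proj₂ (≢-endpoints ∉))))

    side-step : ∀ {u v} → Step u v → ¬ u ∈ₚ A → ¬ v ∈ₚ A → side u ≡ side v
    side-step {a , b}          (inj₁ (refl , inj₁ refl) , su , _) _  v∉ = side-up a b su v∉
    side-step {a , _} {_ , b'} (inj₁ (refl , inj₂ refl) , _ , sv) u∉ _  = sym (side-up a b' sv u∉)
    side-step {a , b}          (inj₂ (refl , inj₁ refl) , su , _) _  v∉ = side-right a b su v∉
    side-step {_ , b} {a' , _} (inj₂ (refl , inj₂ refl) , _ , sv) u∉ _  = sym (side-right a' b sv u∉)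

    side-walk : ∀ {γ δ} (B : Walk γ δ) → (∀ {z} → z ∈ₚ B → ¬ z ∈ₚ A) → side γ ≡ side δ
    side-walk ε _ = refl
    side-walk (s ◅ B) disjoint =
      trans (side-step s (disjoint (inj₁ refl)) (disjoint (inj₂ (∈-start B))))
            (side-walk B (disjoint ∘ inj₂))

  crossesRay-right : ∀ {u v} (adj : Adjacent u v) k → Sq u → crossesRay adj xh k ≡ false
  crossesRay-right {c , y} (inj₁ (refl , inj₁ refl)) k ((_ , c≤) , _) rewrite <ᵇ-false xh c c≤ = refl
  crossesRay-right {c , y} (inj₁ (refl , inj₂ refl)) k ((_ , c≤) , _) rewrite <ᵇ-false xh c c≤ = refl
  crossesRay-right (inj₂ _) k _ = refl

  rayParity-right : ∀ {u v} (W : Walk u v) k → rayParity W xh k ≡ false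
  rayParity-right ε k = refl
  rayParity-right ((adj , su , _) ◅ W) k rewrite crossesRay-right adj k su | rayParity-right W k = refl

  crossesRay-above : ∀ {u v} (adj : Adjacent u v) a → Sq u → Sq v → crossesRay adj a (suc yh) ≡ false
  crossesRay-above {c , y} (inj₁ (refl , inj₁ refl)) a _ (_ , (_ , y<)) rewrite ≡ᵇ-false y yh (<⇒≢ y<) = ∧-zeroʳ _
  crossesRay-above {v = c , y} (inj₁ (refl , inj₂ refl)) a (_ , (_ , y<)) _ rewrite ≡ᵇ-false y yh (<⇒≢ y<) = ∧-zeroʳ _
  crossesRay-above (inj₂ _) a _ _ = refl

  rayParity-above : ∀ {u v} (W : Walk u v) a → rayParity W a (suc yh) ≡ false
  rayParity-above ε a = refl
  rayParity-above ((adj , su , sv) ◅ W) a rewrite crossesRay-above adj a su sv | rayParity-above W a = refl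

  crossesRay-below : ∀ {u v} (adj : Adjacent u v) a → Sq u → Sq v → crossesRay adj a yl ≡ false
  crossesRay-below {c , y} (inj₁ (refl , inj₁ refl)) a (_ , (yl≤ , _)) _
    rewrite ≡ᵇ-false (suc y) yl (λ q → <⇒≢ (s≤s yl≤) (sym q)) = ∧-zeroʳ _
  crossesRay-below {v = c , y} (inj₁ (refl , inj₂ refl)) a _ (_ , (yl≤ , _))
    rewrite ≡ᵇ-false (suc y) yl (λ q → <⇒≢ (s≤s yl≤) (sym q)) = ∧-zeroʳ _
  crossesRay-below (inj₂ _) a _ _ = refl

  rayParity-below : ∀ {u v} (W : Walk u v) a → rayParity W a yl ≡ false
  rayParity-below ε a = refl
  rayParity-below ((adj , su , sv) ◅ W) a rewrite crossesRay-below adj a su sv | rayParity-below W a = refl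

  crossesRow : ∀ {u v} → Adjacent u v → ℕ → Bool
  crossesRow {c , y} (inj₁ (_ , inj₁ _)) k = suc y ≡ᵇ k
  crossesRow {c , y} (inj₁ (_ , inj₂ _)) k = y ≡ᵇ k
  crossesRow (inj₂ _) k = false

  rowParity : ∀ {u v} → Walk u v → ℕ → Bool
  rowParity ε                 k = false
  rowParity ((adj , _) ◅ W) k = crossesRow adj k xor rowParity W k

  rowParity-ends : ∀ {u v} (W : Walk u v) k → rowParity W k ≡ (proj₂ u <ᵇ k) xor (proj₂ v <ᵇ k)
  rowParity-ends {u} ε k = sym (xor-same (proj₂ u <ᵇ k))
  rowParity-ends {u} {w} (_◅_ {j = v} (adj , _) W) k =
    trans (cong₂ _xor_ (step adj) (rowParity-ends W k)) (xor-telescope (proj₂ u <ᵇ k) (proj₂ v <ᵇ k) (proj₂ w <ᵇ k))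
    where
    step : ∀ {u v} (adj : Adjacent u v) → crossesRow adj k ≡ (proj₂ u <ᵇ k) xor (proj₂ v <ᵇ k)
    step {c , y} (inj₁ (refl , inj₁ refl)) = sym (<ᵇ-step y k)
    step {v = c , y} (inj₁ (refl , inj₂ refl)) = sym (trans (xor-comm (suc y <ᵇ k) (y <ᵇ k)) (<ᵇ-step y k))
    step {c , y} (inj₂ (refl , _)) = sym (xor-same (y <ᵇ k))

  -- a ray from the left side crosses every vertical step on its row
  -- except those in its own column, which is column xl
  rayParity-left : ∀ {u v} (W : Walk u v) b → ¬ (xl , b) ∈ₚ W → rayParity W xl (suc b) ≡ rowParity W (suc b)
  rayParity-left ε b _ = refl
  rayParity-left ((adj , su , sv) ◅ W) b ∉ =
    cong₂ _xor_ (step adj su sv (λ e → ∉ (inj₁ (sym e))) (∉-start W (∉ ∘ inj₂))) (rayParity-left W b (∉ ∘ inj₂))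
    where
    step : ∀ {u v} (adj : Adjacent u v) → Sq u → Sq v → u ≢ (xl , b) → v ≢ (xl , b) →
           crossesRay adj xl (suc b) ≡ crossesRow adj (suc b)
    step {c , y} (inj₁ (refl , inj₁ refl)) ((xl≤ , _) , _) _ u≢ _ with y ≡ᵇ b | eq-view y b
    ... | .false | unequal _ = ∧-zeroʳ _
    ... | .true  | equal refl rewrite <ᵇ-true xl c (≤∧≢⇒< xl≤ (λ q → u≢ (cong (_, y) (sym q)))) = refl
    step {v = c , y} (inj₁ (refl , inj₂ refl)) _ ((xl≤ , _) , _) _ v≢ with y ≡ᵇ b | eq-view y b
    ... | .false | unequal _ = ∧-zeroʳ _
    ... | .true  | equal refl rewrite <ᵇ-true xl c (≤∧≢⇒< xl≤ (λ q → v≢ (cong (_, y) (sym q)))) = refl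
    step (inj₂ _) _ _ _ _ = refl

  rayAtBoundary : Point → Point → Bool
  rayAtBoundary E (a , b) = bySide (a , b) (rightOf E a yl) false false (proj₂ E <ᵇ suc b)

  -- at a boundary point off A the ray parity of A is determined by its ends:
  -- for a ray from the bottom side by their positions on the bottom row, for
  -- a ray from the left side by whether they lie below it, and otherwise
  -- the ray leaves the square at once
  rayParity-boundary : ∀ {α β} (A : Walk α β) {a b} → Bd (a , b) → ¬ (a , b) ∈ₚ A →
                       rayParity A a (suc b) ≡ rayAtBoundary α (a , b) xor rayAtBoundary β (a , b)
  rayParity-boundary {α} {β} A {a} {b} bw ∉ =
    trans (by-side (side-of bw)) (sym (cong₂ _xor_ (bySide-onSide (side-of bw) _ _ _ _) (bySide-onSide (side-of bw) _ _ _ _)))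
    where
    by-side : (s : Side (a , b)) → rayParity A a (suc b) ≡
              onSide s (rightOf α a yl) false false (proj₂ α <ᵇ suc b) xor onSide s (rightOf β a yl) false false (proj₂ β <ᵇ suc b)
    by-side (bottom refl _ _) = trans (cong (_xor rayParity A a (suc yl)) (sym (rayParity-below A a))) (rayParity-raise A a yl ∉)
    by-side (right refl _ _)  = rayParity-right A (suc b)
    by-side (top refl _ _)    = rayParity-above A a
    by-side (left refl _ _)   = trans (rayParity-left A b ∉) (rowParity-ends A (suc b))

  onBottomSide onLeftSide : Point → Bool
  onBottomSide w = bySide w true false false false
  onLeftSide   w = bySide w false false false true

  sideTerm : Point → Point → Bool
  sideTerm E w = escape E w xor rayAtBoundary E w

  SideTermLaw : ∀ {c r a b} → Side (c , r) → Side (a , b) → Set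
  SideTermLaw {c} {r} {a} {b} sE sw = (c , r) ≢ (a , b) →
    escape (c , r) (a , b) xor onSide sw (rightOf (c , r) a yl) false false (r <ᵇ suc b) ≡
    precedesˢ sE sw xor (onSide sw false false false true xor onSide sE true false false false)

  sideTerm-bottom : ∀ {c a b} (c1 : xl ≤ c) (c2 : c < xh) (sw : Side (a , b)) →
                    SideTermLaw (bottom {c} {yl} refl c1 c2) sw
  sideTerm-bottom {c} {a} _ c2 (bottom refl _ _) _
    rewrite ≡ᵇ-false c xh (<⇒≢ c2) | ≡ᵇ-false yl yh (<⇒≢ yl<yh) | ≡ᵇ-refl yl = trans (∧-identityʳ _) (<ᵇ-flip a c)
  sideTerm-bottom {c} _ c2 (right refl _ _) _
    rewrite ≡ᵇ-false c xh (<⇒≢ c2) | ≡ᵇ-false yl yh (<⇒≢ yl<yh) = refl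
  sideTerm-bottom {c} _ c2 (top refl _ _) _
    rewrite ≡ᵇ-false c xh (<⇒≢ c2) | ≡ᵇ-false yl yh (<⇒≢ yl<yh) = refl
  sideTerm-bottom {c} {b = b} _ c2 (left refl a1 _) _
    rewrite ≡ᵇ-false c xh (<⇒≢ c2) | ≡ᵇ-false yl yh (<⇒≢ yl<yh) | <ᵇ-true yl (suc b) (m<n⇒m<1+n a1) = refl

  sideTerm-right : ∀ {r a b} (c1 : yl ≤ r) (c2 : r < yh) (sw : Side (a , b)) →
                   SideTermLaw (right {xh} {r} refl c1 c2) sw
  sideTerm-right {r} {a} c1 _ (bottom refl _ a2) _
    rewrite ≡ᵇ-refl xh | <ᵇ-true a xh a2 = trans (cong (_xor (r ≡ᵇ yl)) (<ᵇ-suc-≥ r yl c1)) (xor-same (r ≡ᵇ yl))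
  sideTerm-right _ _ (right refl _ _) _ rewrite ≡ᵇ-refl xh = refl
  sideTerm-right {r} _ c2 (top refl _ _) _
    rewrite ≡ᵇ-refl xh | <ᵇ-true r (suc yh) (m<n⇒m<1+n c2) = refl
  sideTerm-right {r} {b = b} _ _ (left refl _ _) _ rewrite ≡ᵇ-refl xh = xor-same (r <ᵇ suc b)

  sideTerm-top : ∀ {c a b} (c1 : xl < c) (c2 : c ≤ xh) (sw : Side (a , b)) →
                 SideTermLaw (top {c} {yh} refl c1 c2) sw
  sideTerm-top {c} {a} _ _ (bottom refl _ _) _
    rewrite ≡ᵇ-refl yh | ≡ᵇ-false yh yl (>⇒≢ yl<yh) | <ᵇ-false yh (suc yl) yl<yh | ∧-zeroʳ (a <ᵇ c)
          | if-eta (c ≡ᵇ xh) {false} = refl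
  sideTerm-top {c} {b = b} _ _ (right refl _ a2) _
    rewrite ≡ᵇ-refl yh | <ᵇ-false yh (suc b) a2 | ∧-zeroʳ (xh <ᵇ c) | if-eta (c ≡ᵇ xh) {false} = refl
  sideTerm-top {c} {a} _ _ (top refl _ a2) c≢a rewrite ≡ᵇ-refl yh with c ≡ᵇ xh | eq-view c xh
  ... | .true  | equal refl rewrite <ᵇ-true yh (suc yh) ≤-refl | <ᵇ-true a (suc xh) (s≤s a2) = refl
  ... | .false | unequal _ rewrite <ᵇ-true yh (suc yh) ≤-refl =
    cong (_xor false) (trans (∧-identityʳ _) (sym (<ᵇ-suc-≢ a c (λ q → c≢a (cong (_, yh) (sym q))))))
  sideTerm-top {c} {b = b} c1 _ (left refl _ _) _ rewrite ≡ᵇ-refl yh with c ≡ᵇ xh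
  ... | true  = xor-same (yh <ᵇ suc b)
  ... | false rewrite <ᵇ-true xl c c1 = xor-same (yh <ᵇ suc b)

  sideTerm-left : ∀ {r a b} (c1 : yl < r) (c2 : r ≤ yh) (sw : Side (a , b)) →
                  SideTermLaw (left {xl} {r} refl c1 c2) sw
  sideTerm-left {r} {a} _ _ (bottom refl a1 _) _
    rewrite ≡ᵇ-false xl xh (<⇒≢ xl<xh) | <ᵇ-false a xl a1 | if-eta (r ≡ᵇ yh) {false} = refl
  sideTerm-left {r} {a} _ _ (right refl _ _) _
    rewrite ≡ᵇ-false xl xh (<⇒≢ xl<xh) | <ᵇ-false a xl (<⇒≤ xl<xh) | if-eta (r ≡ᵇ yh) {false} = refl
  sideTerm-left {r} {a} _ _ (top refl a1 _) _
    rewrite ≡ᵇ-false xl xh (<⇒≢ xl<xh) | <ᵇ-false a xl (<⇒≤ a1) | if-eta (r ≡ᵇ yh) {false} = refl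
  sideTerm-left {r} {b = b} _ _ (left refl _ _) r≢b
    rewrite ≡ᵇ-false xl xh (<⇒≢ xl<xh) | <ᵇ-false xl xl ≤-refl | if-eta (r ≡ᵇ yh) {false} =
    trans (<ᵇ-flip′ b r) (cong (_xor true) (sym (<ᵇ-suc-≢ b r (λ q → r≢b (cong (xl ,_) (sym q))))))

  sideTerm-sides : ∀ {c r a b} (sE : Side (c , r)) (sw : Side (a , b)) → SideTermLaw sE sw
  sideTerm-sides (bottom refl c1 c2) = sideTerm-bottom c1 c2
  sideTerm-sides (right  refl c1 c2) = sideTerm-right c1 c2
  sideTerm-sides (top    refl c1 c2) = sideTerm-top c1 c2
  sideTerm-sides (left   refl c1 c2) = sideTerm-left c1 c2

  sideTerm-precedes : ∀ E w → Bd E → Bd w → E ≢ w →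
                      sideTerm E w ≡ precedes E w xor (onLeftSide w xor onBottomSide E)
  sideTerm-precedes (c , r) (a , b) bE bw E≢w
    rewrite bySide-onSide (side-of bw) (rightOf (c , r) a yl) false false (r <ᵇ suc b)
          | bySide-onSide (side-of bw) false false false true
          | bySide-onSide (side-of bE) true false false false
          | precedes-onSide (side-of bE) (side-of bw) = sideTerm-sides (side-of bE) (side-of bw) E≢w

  side-arcParity : ∀ {α β} (A : Walk α β) (bα : Bd α) (bβ : Bd β) w → Bd w → ¬ w ∈ₚ A →
                   Separation.side A bα bβ w ≡ arcParity α β w xor (onBottomSide α xor onBottomSide β)
  side-arcParity {α} {β} A bα bβ (a , b) bw ∉ = begin
    rayParity A a (suc b) xor (escape α w xor escape β w)
      ≡⟨ cong (_xor (escape α w xor escape β w)) (rayParity-boundary A bw ∉) ⟩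
    (rayAtBoundary α w xor rayAtBoundary β w) xor (escape α w xor escape β w)
      ≡⟨ xor-interchange (rayAtBoundary α w) (rayAtBoundary β w) (escape α w) (escape β w) ⟩
    (rayAtBoundary α w xor escape α w) xor (rayAtBoundary β w xor escape β w)
      ≡⟨ cong₂ _xor_ (xor-comm (rayAtBoundary α w) (escape α w)) (xor-comm (rayAtBoundary β w) (escape β w)) ⟩
    sideTerm α w xor sideTerm β w
      ≡⟨ cong₂ _xor_ (sideTerm-precedes α w bα bw (λ { refl → ∉ (∈-start A) }))
                     (sideTerm-precedes β w bβ bw (λ { refl → ∉ (∈-end A) })) ⟩
    (precedes α w xor (onLeftSide w xor onBottomSide α)) xor (precedes β w xor (onLeftSide w xor onBottomSide β))
      ≡⟨ xor-interchange (precedes α w) _ (precedes β w) _ ⟩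
    arcParity α β w xor ((onLeftSide w xor onBottomSide α) xor (onLeftSide w xor onBottomSide β))
      ≡⟨ cong (arcParity α β w xor_) (xor-interchange (onLeftSide w) (onBottomSide α) (onLeftSide w) (onBottomSide β)) ⟩
    arcParity α β w xor ((onLeftSide w xor onLeftSide w) xor (onBottomSide α xor onBottomSide β))
      ≡⟨ cong (λ z → arcParity α β w xor (z xor (onBottomSide α xor onBottomSide β))) (xor-same (onLeftSide w)) ⟩
    arcParity α β w xor (onBottomSide α xor onBottomSide β) ∎
    where
    w : Point
    w = (a , b)

  walks-meet : ∀ {x α β γ δ eα eβ eγ eδ} (A : Walk α β) (B : Walk δ γ) →
               Bd x → Bd α → Bd β → Bd γ → Bd δ →
               Exp x α eα → Exp x β eβ → Exp x γ eγ → Exp x δ eδ →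
               Between eα eβ eγ → Outside eα eβ eδ → ∃[ z ] z ∈ₚ A × z ∈ₚ B
  walks-meet {x} {α} {β} {γ} {δ} {eα} {eβ} {eγ} {eδ} A B bx bα bβ bγ bδ xα xβ xγ xδ between outside
    with meet-or-disjoint A B
  ... | inj₁ meet     = meet
  ... | inj₂ disjoint = ⊥-elim (inRange-separates eα eβ eγ eδ between outside same-parity)
    where
    open Separation A bα bβ
    c : Bool
    c = onBottomSide α xor onBottomSide β
    same-arc : arcParity α β γ ≡ arcParity α β δ
    same-arc = xor-cancelʳ c _ _ (begin
      arcParity α β γ xor c  ≡⟨ side-arcParity A bα bβ γ bγ (disjoint (∈-end B)) ⟨
      side γ                 ≡⟨ side-walk B disjoint ⟨
      side δ                 ≡⟨ side-arcParity A bα bβ δ bδ (disjoint (∈-start B)) ⟩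
      arcParity α β δ xor c  ∎)
    same-parity : inRange eα eγ xor inRange eβ eγ ≡ inRange eα eδ xor inRange eβ eδ
    same-parity = xor-cancelˡ (arcParity α β x) _ _ (begin
      arcParity α β x xor (inRange eα eγ xor inRange eβ eγ) ≡⟨ arcParity-exponent bα bβ bx xα xβ xγ ⟨
      arcParity α β γ                                       ≡⟨ same-arc ⟩
      arcParity α β δ                                       ≡⟨ arcParity-exponent bα bβ bx xα xβ xδ ⟩
      arcParity α β x xor (inRange eα eδ xor inRange eβ eδ) ∎)

  min-end : ∀ {x u v q r} → Exp x u q → Exp x v r → ccw^ t i j (q ⊓ r) x ≡ u ⊎ ccw^ t i j (q ⊓ r) x ≡ v
  min-end {x} {q = q} {r} xu xv with ≤-total q r
  ... | inj₁ q≤r = inj₁ (trans (cong (λ n → ccw^ t i j n x) (m≤n⇒m⊓n≡m q≤r)) (proj₁ xu))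
  ... | inj₂ r≤q = inj₂ (trans (cong (λ n → ccw^ t i j n x) (m≥n⇒m⊓n≡n r≤q)) (proj₁ xv))

  module Paths (R : Point → Point → Set) (R⇒Step : ∀ {u v} → R u v → Step u v) where

    walk : ∀ {u v} → Star R u v → Walk u v
    walk = map R⇒Step

    splice : ∀ {u v u' v' z} (P : Star R u v) (Q : Star R u' v') → z ∈ₚ P → z ∈ₚ Q → Star R u v'
    splice P Q z∈P z∈Q = Split.prefix (split P z∈P) ◅◅ Split.suffix (split Q z∈Q)

    record WalkToNearEnd (x z : Point) {u v : Point} (P : Star R u v) (e : ℕ) : Set where
      field
        end    : Point
        Bd-end : Bd end
        Exp-end : Exp x end e
        route  : Walk z end
        route⊆ : route ⊆ₚ P

    walk-to-near-end : ∀ {x z u v q r} → Bd u → Bd v → Exp x u q → Exp x v r →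
                       (P : Star R u v) → z ∈ₚ P → WalkToNearEnd x z P (q ⊓ r)
    walk-to-near-end {x} {z} {q = q} {r} bu bv xu xv P z∈P with ≤-total q r
    ... | inj₁ q≤r = record
      { end = _ ; Bd-end = bu ; Exp-end = subst (Exp x _) (sym (m≤n⇒m⊓n≡m q≤r)) xu
      ; route  = reverse Step-sym (walk (Split.prefix S))
      ; route⊆ = λ m → Split.prefix⊆ S (∈-map (Split.prefix S) (∈-reverse Step-sym (walk (Split.prefix S)) m)) }
      where
      S : Split z P
      S = split P z∈P
    ... | inj₂ r≤q = record
      { end = _ ; Bd-end = bv ; Exp-end = subst (Exp x _) (sym (m≥n⇒m⊓n≡n r≤q)) xv
      ; route  = walk (Split.suffix S)
      ; route⊆ = λ m → Split.suffix⊆ S (∈-map (Split.suffix S) m) }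
      where
      S : Split z P
      S = split P z∈P

    -- P meets P₂ at some z (P runs from
    -- x, outside P₂'s ends, to y, between them).  Following P up to z and
    -- then P₂ to its end nearer to x gives a walk from x to a point between
    -- the ends of P₁, so it meets P₁ at some z' (for z' = x when x is an
    -- end of P₁).  If z' lies on P₂, splice P₁ and P₂ there; otherwise go
    -- u₁ → z' along P₁, z' → z along P and z → v₂ along P₂.
    crossing-paths : ∀ {u₁ v₁ u₂ v₂ x y q₁ r₁ q₂ r₂ p} →
      Bd u₁ → Bd v₁ → Bd u₂ → Bd v₂ → Bd x → Bd y →
      Exp x u₁ q₁ → Exp x v₁ r₁ → Exp x u₂ q₂ → Exp x v₂ r₂ → Exp x y p →
      Between q₁ r₁ p → Between q₂ r₂ p → q₁ ⊓ r₁ < q₂ ⊓ r₂ →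
      Star R u₁ v₁ → Star R u₂ v₂ → Star R x y → Star R u₁ v₂
    crossing-paths {u₁} {v₁} {v₂ = v₂} {x} {q₁ = q₁} {r₁} {q₂} {r₂}
                   bu₁ bv₁ bu₂ bv₂ bx by xu₁ xv₁ xu₂ xv₂ xy between₁ between₂ a₁<a₂ P₁ P₂ P
      with walks-meet {eδ = 0} (walk P₂) (walk P) bx bu₂ bv₂ by bx xu₂ xv₂ xy (exponent-zero x)
                      between₂ (inj₁ (≤-trans (s≤s z≤n) a₁<a₂))
    ... | z , z∈P₂ , z∈P = result
      where
      N : WalkToNearEnd x z P₂ (q₂ ⊓ r₂)
      N = walk-to-near-end bu₂ bv₂ xu₂ xv₂ P₂ (∈-map P₂ z∈P₂)
      open WalkToNearEnd N

      P-to-z : Star R x z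
      P-to-z = Split.prefix (split P (∈-map P z∈P))

      meets-P₁ : ∃[ z' ] z' ∈ₚ walk P₁ × z' ∈ₚ (walk P-to-z ◅◅ route)
      meets-P₁ with (q₁ ⊓ r₁) ≟ 0
      ... | yes a₁≡0 = x , ∈-endpoint (walk P₁) (subst (λ n → ccw^ t i j n x ≡ u₁ ⊎ ccw^ t i j n x ≡ v₁) a₁≡0 (min-end xu₁ xv₁))
                         , ∈-start (walk P-to-z ◅◅ route)
      ... | no  a₁≢0 = walks-meet {eδ = 0} (walk P₁) (walk P-to-z ◅◅ route) bx bu₁ bv₁ Bd-end bx xu₁ xv₁ Exp-end (exponent-zero x)
                         (a₁<a₂ , <-trans (proj₁ between₂) (proj₂ between₁)) (inj₁ (≤∧≢⇒< z≤n (λ e → a₁≢0 (sym e))))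

      result : Star R u₁ v₂
      result with meets-P₁
      ... | z' , z'∈P₁ , z'∈C with ∈-◅◅ (walk P-to-z) route z'∈C
      ...   | inj₂ z'∈route = splice P₁ P₂ (∈-map P₁ z'∈P₁) (route⊆ z'∈route)
      ...   | inj₁ z'∈P-to-z =
        Split.prefix (split P₁ (∈-map P₁ z'∈P₁))
          ◅◅ Split.suffix (split P-to-z (∈-map P-to-z z'∈P-to-z))
          ◅◅ Split.suffix (split P₂ (∈-map P₂ z∈P₂))

side-positive : ∀ {k t} → AdmissibleSplit k t → 1 ≤ k → 1 ≤ t
side-positive (inj₁ (_ , 2≤t))          _ = ≤-trans (s≤s z≤n) 2≤t
side-positive (inj₂ (inj₁ (_ , refl))) _ = s≤s z≤n
side-positive (inj₂ (inj₂ (refl , _))) ()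

lo<hi : ∀ t i → 1 ≤ t → 1 ≤ i → lo t i < hi t i
lo<hi t (suc i) 1≤t _ = m<n+m (i * t) 1≤t

-- Lemma 3 is crossing-paths for the block G[i, j], whose paths consist of
-- grid edges inside its square; the exponents in the two crossings and in
-- the closeness condition agree by uniqueness of exponents.

lemma3 : (m k t : ℕ) → AdmissibleSplit k t → m ≡ k * t →
         (G : GridGraph m) → (i j : ℕ) → 1 ≤ i → i ≤ k → 1 ≤ j → j ≤ k →
         (u₁ v₁ u₂ v₂ x y : Point) →
         BlockEdge G t i j u₁ v₁ → BlockEdge G t i j u₂ v₂ →
         BlockEdge G t i j x y →
         Crosses t i j (x , y) (u₁ , v₁) → Crosses t i j (x , y) (u₂ , v₂) →
         Closer t i j x (u₁ , v₁) (u₂ , v₂) →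
         BlockEdge G t i j u₁ v₂
lemma3 _ _ t adm _ G i j 1≤i i≤k 1≤j _ u₁ v₁ u₂ v₂ x y
       (bu₁ , bv₁ , P₁) (bu₂ , bv₂ , P₂) (bx , by , P)
       (_ , _ , q₁ , r₁ , xy  , xu₁ , xv₁ , between₁)
       (_ , _ , q₂ , r₂ , xy' , xu₂ , xv₂ , between₂)
       (_ , _ , _ , _ , xu₁' , xv₁' , xu₂' , xv₂' , closer) =
  bu₁ , bv₂ ,
  crossing-paths bu₁ bv₁ bu₂ bv₂ bx by xu₁ xv₁ xu₂ xv₂ xy
    between₁ (subst (Between q₂ r₂) (exponent-unique xy' xy) between₂)
    (subst₂ _<_ (cong₂ _⊓_ (exponent-unique xu₁' xu₁) (exponent-unique xv₁' xv₁))
                (cong₂ _⊓_ (exponent-unique xu₂' xu₂) (exponent-unique xv₂' xv₂)) closer)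
    P₁ P₂ P
  where
  1≤t : 1 ≤ t
  1≤t = side-positive adm (≤-trans 1≤i i≤k)
  open Square t i j (lo<hi t i 1≤t 1≤i) (lo<hi t j 1≤t 1≤j)
  open Paths (SubEdge G t i j) (λ (e , su , sv) → edge-adjacent G e , su , sv)
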